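{- Let $p\ge2$ and $r_1,\dots,r_p\ge1$ be integers, $\mathbf r_p=(r_1,\dots,r_p)$, $|\mathbf r_p|=r_1+\cdots+r_p$. For $n\ge0$ define the polynomial \[ B(\lambda;K_{n,\mathbf r_p}):=\sum_{k\geq0}{n+|\mathbf r_p| \brace k}_{\!K(\mathbf r_p)}\lambda^k . \] Then \[ B(\lambda;K_{n,\mathbf r_p})=\lambda e^{ -\lambda}\frac{d}{d\lambda}\Big(e^{\lambda}B(\lambda;K_{n-1,\mathbf r_p})\Big),\qquad n\geq1, \] and \[ B(\lambda;K_{0,\mathbf r_p})=B_{r_1}(\lambda)\cdots B_{r_p}(\lambda), \] where $B_m(\lambda)=\sum_{j=0}^{m}{m\brace j}\lambda^j$ is the classical Bell (Touchard) polynomial and ${m\brace j}$ are the Stirling numbers of the second kind.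
   Context: For integers $N\ge0$ and $r_1,\dots,r_p$, let $R_1,\dots,R_p$ be pairwise disjoint subsets of $\{1,\dots,N\}$ with $|R_i|=r_i$; the $K(r_1,\dots,r_p)$-Stirling number ${N\brace k}_{K(r_1,\dots,r_p)}$ is the number of partitions of $\{1,\dots,N\}$ into $k$ nonempty blocks such that no block contains both an element of $R_i$ and an element of $R_j$ for $i\neq j$ (independent of the choice of the $R_i$). -}

module Defs where

open import Data.Nat using (ℕ; zero; suc; _+_; _*_; _∸_; _<ᵇ_; _≤ᵇ_)
open import Data.Bool using (Bool; true; false; _∧_; _∨_; not; if_then_else_)
open import Data.Fin using (Fin; zero; suc; toℕ; _≟_)
open import Data.Maybe using (Maybe; just; nothing)
import Data.Maybe as Maybe
open import Data.List using (List; []; _∷_; concatMap; map; length; filter)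
open import Relation.Nullary.Decidable using (⌊_⌋)
open import Relation.Unary using (Pred)
open import Data.Bool using (T)
open import Data.Bool.Properties using (T?)

allFin : (n : ℕ) → (Fin n → Bool) → Bool
allFin zero    P = true
allFin (suc n) P = P zero ∧ allFin n (λ i → P (suc i))

sumFin : (n : ℕ) → (Fin n → ℕ) → ℕ
sumFin zero    f = 0
sumFin (suc n) f = f zero + sumFin n (λ i → f (suc i))

allFunsOf : {A : Set} → List A → (n : ℕ) → List (Fin n → A)
allFunsOf xs zero    = (λ ()) ∷ []
allFunsOf xs (suc n) =
  concatMap (λ a → map (λ f → λ { zero → a ; (suc i) → f i }) (allFunsOf xs n)) xs

allRelations : (N : ℕ) → List (Fin N → Fin N → Bool)
allRelations N = allFunsOf (allFunsOf (true ∷ false ∷ []) N) N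

-- Set partitions of {1..N} = Fin N, encoded as equivalence relations
-- (the blocks are the equivalence classes).

_⇒ᵇ_ : Bool → Bool → Bool
a ⇒ᵇ b = not a ∨ b

isEquivalence : (N : ℕ) → (Fin N → Fin N → Bool) → Bool
isEquivalence N R =
  allFin N (λ i → R i i) ∧
  (allFin N (λ i → allFin N (λ j → R i j ⇒ᵇ R j i)) ∧
   allFin N (λ i → allFin N (λ j → allFin N (λ l → (R i j ∧ R j l) ⇒ᵇ R i l))))

-- number of blocks (equivalence classes) = number of elements that are the
-- least element of their class
numBlocks : (N : ℕ) → (Fin N → Fin N → Bool) → ℕ
numBlocks N R =
  sumFin N (λ i → if allFin N (λ j → (toℕ j <ᵇ toℕ i) ⇒ᵇ not (R j i)) then 1 else 0)

-- The distinguished subsets R_1,...,R_p: an element x of Fin N gets the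
-- "colour" i if x ∈ R_i, and no colour otherwise.  Canonical choice:
-- R_1 = the first r_1 elements, R_2 = the next r_2 elements, etc.
-- (0-based: colour zero corresponds to R_1.)

colour : (p : ℕ) → (Fin p → ℕ) → ℕ → Maybe (Fin p)
colour zero    r x = nothing
colour (suc p) r x =
  if x <ᵇ r zero then just zero
  else Maybe.map suc (colour p (λ i → r (suc i)) (x ∸ r zero))

sameColourOrFree : {p : ℕ} → Maybe (Fin p) → Maybe (Fin p) → Bool
sameColourOrFree (just a) (just b) = ⌊ a ≟ b ⌋
sameColourOrFree _        _        = true

admissible : (p : ℕ) → (Fin p → ℕ) → (N : ℕ) → (Fin N → Fin N → Bool) → Bool
admissible p r N R =
  allFin N (λ i → allFin N (λ j →
    R i j ⇒ᵇ sameColourOrFree (colour p r (toℕ i)) (colour p r (toℕ j))))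

KStirling : (p : ℕ) → (Fin p → ℕ) → (N k : ℕ) → ℕ
KStirling p r N k =
  length (filter (λ R → T? (isEquivalence N R ∧ (admissible p r N R ∧ (numBlocks N R ≡ᵇ k))))
                 (allRelations N))
  where open import Data.Nat using (_≡ᵇ_)

stirling2 : (m j : ℕ) → ℕ
stirling2 m j = KStirling 0 (λ ()) m j

-- Polynomials in λ with ℕ coefficients, as coefficient sequences ℕ → ℕ
-- (coefficient of λ^k).  Equality of polynomials = coefficientwise equality.

Poly : Set
Poly = ℕ → ℕ

_+ₚ_ : Poly → Poly → Poly
(f +ₚ g) k = f k + g k

λ*ₚ : Poly → Poly
λ*ₚ f zero    = 0
λ*ₚ f (suc k) = f k

deriv : Poly → Poly
deriv f k = suc k * f (suc k)

_*ₚ_ : Poly → Poly → Poly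
(f *ₚ g) k = sumFin (suc k) (λ i → f (toℕ i) * g (k ∸ toℕ i))

oneₚ : Poly
oneₚ zero    = 1
oneₚ (suc k) = 0

prodPoly : (p : ℕ) → (Fin p → Poly) → Poly
prodPoly zero    f = oneₚ
prodPoly (suc p) f = f zero *ₚ prodPoly p (λ i → f (suc i))

-- λ e^{-λ} d/dλ ( e^{λ} f ) , which by the product rule (d/dλ e^λ = e^λ)
-- equals λ (f + f').
λe⁻ᵏDeᵏ : Poly → Poly
λe⁻ᵏDeᵏ f = λ*ₚ (f +ₚ deriv f)

bell : ℕ → Poly
bell m j = if j ≤ᵇ m then stirling2 m j else 0

size : (p : ℕ) → (Fin p → ℕ) → ℕ
size p r = sumFin p r

BK : (p : ℕ) → (Fin p → ℕ) → ℕ → Poly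
BK p r n k = KStirling p r (n + size p r) k

module Submission where

-- Both identities are proved by counting admissible partitions directly.
-- A partition of Fin N is encoded (Defs) as a boolean relation that is an
-- equivalence, and ∑ₖ {N brace k}_{K(r)} λ^k is the sum, over the list of all
-- relations, of the weight "λ^{#blocks} if the relation is an admissible
-- equivalence, else 0" (KStirling-∑).  Summing over relations on Fin (a + b)
-- is summing over their four blocks A B / C D (∑-rel-blocks), and the number
-- of blocks of a glued relation is read off from the block leaders
-- (numBlocks-glue).  Then:
--  * recurrence: Fin (M + 1) is Fin M plus one uncoloured point.  An
--    equivalence on it is an equivalence R on Fin M together with the class of
--    the new point: either a new singleton block or one of the numBlocks R
--    classes of R (∑-weight-adjoin).  On weights this is exactly
--    λ e^{-λ} d/dλ (e^λ λ^m) = λ^{m+1} + m λ^m (λe⁻ᵏDeᵏ-mono), and linearity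
--    of that operator gives the recurrence.
--  * initial value: Fin |r| is the first colour class followed by the other
--    colours.  Admissibility forces the off-diagonal blocks to be empty, so the
--    weight factors as a Cauchy product (∑-weight-split); the first factor sums
--    to the Bell polynomial, and induction on p gives the product formula.

open import Defs
open import Data.Nat using (ℕ; zero; suc; _+_; _*_; _∸_; _<ᵇ_; _≤ᵇ_; _≡ᵇ_; _≤_; _<_; z≤n; s≤s)
open import Data.Nat.Properties
open import Data.Bool using (Bool; true; false; _∧_; not; if_then_else_; T)
open import Data.Bool.Properties using (T?; ∧-assoc; ∧-identityʳ)
open import Data.Fin using (Fin; zero; suc; toℕ; _↑ˡ_; _↑ʳ_; splitAt)
open import Data.Maybe using (Maybe; just; nothing)
import Data.Maybe as Maybe
open import Data.List using (List; []; _∷_; concatMap; map; length; filter; _++_)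
open import Data.Product using (_×_; _,_; Σ)
open import Data.Sum using (_⊎_; inj₁; inj₂; [_,_])
open import Data.Vec.Functional using () renaming (_∷_ to _◂_; _++_ to _++ᵥ_)
open import Data.Vec.Functional.Properties using (lookup-++ˡ; lookup-++ʳ)
open import Data.Fin.Properties using (toℕ-↑ˡ; toℕ-↑ʳ; toℕ<n; toℕ-injective) renaming (suc-injective to Fin-suc-injective)
open import Data.Empty using (⊥-elim)
open import Relation.Nullary using (¬_; Dec; yes; no)
open import Relation.Nullary.Decidable using (toWitness; fromWitness)
open import Relation.Binary.Definitions using (tri<; tri≈; tri>)
open import Relation.Binary.PropositionalEquality hiding (isEquivalence; [_])
open import Data.Nat.Tactic.RingSolver using (solve-∀)
open import Algebra.Properties.CommutativeSemigroup +-commutativeSemigroup using () renaming (interchange to +-interchange)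
open import Algebra.Properties.CommutativeSemigroup *-commutativeSemigroup using ()
  renaming (interchange to *-interchange; x∙yz≈y∙xz to *-swapˡ)
open ≡-Reasoning

⟦_⟧ : Bool → ℕ
⟦ b ⟧ = if b then 1 else 0

⟦∧⟧ : (a b : Bool) → ⟦ a ∧ b ⟧ ≡ ⟦ a ⟧ * ⟦ b ⟧
⟦∧⟧ true  b = sym (+-identityʳ ⟦ b ⟧)
⟦∧⟧ false b = refl

⟦false⟧ : {a : Bool} → ¬ T a → ⟦ a ⟧ ≡ 0
⟦false⟧ {false} _ = refl
⟦false⟧ {true}  h = ⊥-elim (h _)

⟦true⟧ : {a : Bool} → T a → ⟦ a ⟧ ≡ 1
⟦true⟧ {true} _ = refl

∑ : {A : Set} → List A → (A → ℕ) → ℕ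
∑ []       f = 0
∑ (x ∷ xs) f = f x + ∑ xs f

length-filter : {A : Set} (b : A → Bool) (xs : List A) →
  length (filter (λ x → T? (b x)) xs) ≡ ∑ xs (λ x → ⟦ b x ⟧)
length-filter b []       = refl
length-filter b (x ∷ xs) with b x
... | true  = cong suc (length-filter b xs)
... | false = length-filter b xs

∑-cong : {A : Set} (xs : List A) {f g : A → ℕ} → (∀ x → f x ≡ g x) → ∑ xs f ≡ ∑ xs g
∑-cong []       e = refl
∑-cong (x ∷ xs) e = cong₂ _+_ (e x) (∑-cong xs e)

∑-++ : {A : Set} (xs ys : List A) (f : A → ℕ) → ∑ (xs ++ ys) f ≡ ∑ xs f + ∑ ys f
∑-++ []       ys f = refl
∑-++ (x ∷ xs) ys f = trans (cong (f x +_) (∑-++ xs ys f)) (sym (+-assoc (f x) _ _))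

∑-map : {A B : Set} (h : A → B) (xs : List A) (f : B → ℕ) → ∑ (map h xs) f ≡ ∑ xs (λ x → f (h x))
∑-map h []       f = refl
∑-map h (x ∷ xs) f = cong (f (h x) +_) (∑-map h xs f)

∑-concatMap : {A B : Set} (h : A → List B) (xs : List A) (f : B → ℕ) →
  ∑ (concatMap h xs) f ≡ ∑ xs (λ x → ∑ (h x) f)
∑-concatMap h []       f = refl
∑-concatMap h (x ∷ xs) f = trans (∑-++ (h x) (concatMap h xs) f) (cong (∑ (h x) f +_) (∑-concatMap h xs f))

∑-0 : {A : Set} (xs : List A) → ∑ xs (λ _ → 0) ≡ 0
∑-0 []       = refl
∑-0 (x ∷ xs) = ∑-0 xs

∑-+ : {A : Set} (xs : List A) (f g : A → ℕ) → ∑ xs (λ x → f x + g x) ≡ ∑ xs f + ∑ xs g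
∑-+ []       f g = refl
∑-+ (x ∷ xs) f g = trans (cong (f x + g x +_) (∑-+ xs f g)) (+-interchange (f x) (g x) (∑ xs f) (∑ xs g))

∑-*ˡ : {A : Set} (xs : List A) (c : ℕ) (f : A → ℕ) → ∑ xs (λ x → c * f x) ≡ c * ∑ xs f
∑-*ˡ []       c f = sym (*-zeroʳ c)
∑-*ˡ (x ∷ xs) c f = trans (cong (c * f x +_) (∑-*ˡ xs c f)) (sym (*-distribˡ-+ c (f x) (∑ xs f)))

∑-*ʳ : {A : Set} (xs : List A) (c : ℕ) (f : A → ℕ) → ∑ xs (λ x → f x * c) ≡ ∑ xs f * c
∑-*ʳ xs c f = trans (∑-cong xs (λ x → *-comm (f x) c)) (trans (∑-*ˡ xs c f) (*-comm c (∑ xs f)))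

∑-swap : {A B : Set} (xs : List A) (ys : List B) (f : A → B → ℕ) →
  ∑ xs (λ x → ∑ ys (f x)) ≡ ∑ ys (λ y → ∑ xs (λ x → f x y))
∑-swap []       ys f = sym (∑-0 ys)
∑-swap (x ∷ xs) ys f =
  trans (cong (∑ ys (f x) +_) (∑-swap xs ys f)) (sym (∑-+ ys (f x) (λ y → ∑ xs (λ x′ → f x′ y))))

sumFin-cong : (n : ℕ) {f g : Fin n → ℕ} → (∀ i → f i ≡ g i) → sumFin n f ≡ sumFin n g
sumFin-cong zero    e = refl
sumFin-cong (suc n) e = cong₂ _+_ (e zero) (sumFin-cong n (λ i → e (suc i)))

sumFin-0 : (n : ℕ) → sumFin n (λ _ → 0) ≡ 0
sumFin-0 zero    = refl
sumFin-0 (suc n) = sumFin-0 n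

sumFin-+ : (n : ℕ) (f g : Fin n → ℕ) → sumFin n (λ i → f i + g i) ≡ sumFin n f + sumFin n g
sumFin-+ zero    f g = refl
sumFin-+ (suc n) f g =
  trans (cong (f zero + g zero +_) (sumFin-+ n _ _)) (+-interchange (f zero) (g zero) _ _)

∑-sumFin : {A : Set} (xs : List A) (n : ℕ) (f : A → Fin n → ℕ) →
  ∑ xs (λ x → sumFin n (f x)) ≡ sumFin n (λ i → ∑ xs (λ x → f x i))
∑-sumFin []       n f = sym (sumFin-0 n)
∑-sumFin (x ∷ xs) n f =
  trans (cong (sumFin n (f x) +_) (∑-sumFin xs n f)) (sym (sumFin-+ n (f x) (λ i → ∑ xs (λ x′ → f x′ i))))

sumFin-*ˡ : (n c : ℕ) (f : Fin n → ℕ) → sumFin n (λ i → c * f i) ≡ c * sumFin n f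
sumFin-*ˡ zero    c f = sym (*-zeroʳ c)
sumFin-*ˡ (suc n) c f =
  trans (cong (c * f zero +_) (sumFin-*ˡ n c _)) (sym (*-distribˡ-+ c (f zero) _))

sumFin-unique : (n : ℕ) (f : Fin n → ℕ) (m : Fin n) → f m ≡ 1 → (∀ i → i ≢ m → f i ≡ 0) → sumFin n f ≡ 1
sumFin-unique (suc n) f zero    fm rest =
  trans (cong₂ _+_ fm (trans (sumFin-cong n (λ i → rest (suc i) (λ ()))) (sumFin-0 n))) refl
sumFin-unique (suc n) f (suc m) fm rest = trans (cong (_+ sumFin n (λ i → f (suc i))) (rest zero (λ ())))
  (sumFin-unique n (λ i → f (suc i)) m fm (λ i i≢m → rest (suc i) (λ eq → i≢m (Fin-suc-injective eq))))

sumFin-split : (a b : ℕ) (f : Fin (a + b) → ℕ) →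
  sumFin (a + b) f ≡ sumFin a (λ i → f (i ↑ˡ b)) + sumFin b (λ j → f (a ↑ʳ j))
sumFin-split zero    b f = refl
sumFin-split (suc a) b f =
  trans (cong (f zero +_) (sumFin-split a b (λ i → f (suc i)))) (sym (+-assoc (f zero) _ _))

∧-intro : {a b : Bool} → T a → T b → T (a ∧ b)
∧-intro {true} {true} _ _ = _

∧-fst : {a b : Bool} → T (a ∧ b) → T a
∧-fst {true} _ = _

∧-snd : {a b : Bool} → T (a ∧ b) → T b
∧-snd {true} t = t

⇒-intro : {a b : Bool} → (T a → T b) → T (a ⇒ᵇ b)
⇒-intro {false} h = _
⇒-intro {true}  h = h _

⇒-elim : {a b : Bool} → T (a ⇒ᵇ b) → T a → T b
⇒-elim {true} t _ = t

⇒-cong : {a b c d : Bool} → a ≡ b → c ≡ d → (a ⇒ᵇ c) ≡ (b ⇒ᵇ d)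
⇒-cong refl refl = refl

not-intro : {a : Bool} → ¬ T a → T (not a)
not-intro {false} _ = _
not-intro {true}  h = h _

not-elim : {a : Bool} → T (not a) → ¬ T a
not-elim {false} _ ()

T-back : {x y : Bool} → x ≡ y → T y → T x
T-back eq = subst T (sym eq)

bool-ext : {a b : Bool} → (T a → T b) → (T b → T a) → a ≡ b
bool-ext {false} {false} f g = refl
bool-ext {false} {true}  f g = ⊥-elim (g _)
bool-ext {true}  {false} f g = ⊥-elim (f _)
bool-ext {true}  {true}  f g = refl

allFin-intro : (n : ℕ) {P : Fin n → Bool} → (∀ i → T (P i)) → T (allFin n P)
allFin-intro zero    h = _
allFin-intro (suc n) h = ∧-intro (h zero) (allFin-intro n (λ i → h (suc i)))

allFin-elim : (n : ℕ) {P : Fin n → Bool} → T (allFin n P) → ∀ i → T (P i)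
allFin-elim (suc n)     t zero    = ∧-fst t
allFin-elim (suc n) {P} t (suc i) = allFin-elim n (∧-snd {P zero} t) i

allFin-witness : (n : ℕ) (P : Fin n → Bool) → ¬ T (allFin n P) → Σ (Fin n) (λ i → ¬ T (P i))
allFin-witness zero    P h = ⊥-elim (h _)
allFin-witness (suc n) P h with T? (P zero)
... | no  ¬p = zero , ¬p
... | yes p with allFin-witness n (λ i → P (suc i)) (λ t → h (∧-intro p t))
...   | i , ¬q = suc i , ¬q

allFin-cong : (n : ℕ) {P Q : Fin n → Bool} → (∀ i → P i ≡ Q i) → allFin n P ≡ allFin n Q
allFin-cong zero    e = refl
allFin-cong (suc n) e = cong₂ _∧_ (e zero) (allFin-cong n (λ i → e (suc i)))

allFin-split : (a b : ℕ) (P : Fin (a + b) → Bool) →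
  allFin (a + b) P ≡ allFin a (λ i → P (i ↑ˡ b)) ∧ allFin b (λ j → P (a ↑ʳ j))
allFin-split zero    b P = refl
allFin-split (suc a) b P =
  trans (cong (P zero ∧_) (allFin-split a b (λ i → P (suc i)))) (sym (∧-assoc (P zero) _ _))

T⇒≡true : {a : Bool} → T a → a ≡ true
T⇒≡true {true} _ = refl

¬T⇒≡false : {a : Bool} → ¬ T a → a ≡ false
¬T⇒≡false {false} _ = refl
¬T⇒≡false {true}  h = ⊥-elim (h _)

agree : Bool → Bool → Bool
agree x true  = x
agree x false = not x

agree-sound : {x y : Bool} → T (agree x y) → x ≡ y
agree-sound {true}  {true}  _ = refl
agree-sound {false} {false} _ = refl

agree-complete : {x y : Bool} → x ≡ y → T (agree x y)
agree-complete {true}  refl = _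
agree-complete {false} refl = _

Rel : ℕ → ℕ → Set
Rel m n = Fin m → Fin n → Bool

_≐_ : {m n : ℕ} → Rel m n → Rel m n → Set
R ≐ R′ = ∀ i j → R i j ≡ R′ i j

record IsEquiv {N : ℕ} (R : Rel N N) : Set where
  field
    reflexive  : ∀ i → T (R i i)
    symmetric  : ∀ i j → T (R i j) → T (R j i)
    transitive : ∀ i j l → T (R i j) → T (R j l) → T (R i l)

isEquivalence-complete : (N : ℕ) (R : Rel N N) → IsEquiv R → T (isEquivalence N R)
isEquivalence-complete N R e = ∧-intro (allFin-intro N reflexive)
  (∧-intro (allFin-intro N (λ i → allFin-intro N (λ j → ⇒-intro (symmetric i j))))
           (allFin-intro N (λ i → allFin-intro N (λ j → allFin-intro N (λ l →
              ⇒-intro (λ t → transitive i j l (∧-fst t) (∧-snd {R i j} t)))))))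
  where open IsEquiv e

isEquivalence-sound : (N : ℕ) (R : Rel N N) → T (isEquivalence N R) → IsEquiv R
isEquivalence-sound N R t = record
  { reflexive  = allFin-elim N (∧-fst t)
  ; symmetric  = λ i j → ⇒-elim (allFin-elim N (allFin-elim N (∧-fst symTrans) i) j)
  ; transitive = λ i j l p q →
      ⇒-elim (allFin-elim N (allFin-elim N (allFin-elim N (∧-snd symTrans) i) j) l) (∧-intro p q)
  }
  where
  symTrans : T (allFin N (λ i → allFin N (λ j → R i j ⇒ᵇ R j i)) ∧
                allFin N (λ i → allFin N (λ j → allFin N (λ l → (R i j ∧ R j l) ⇒ᵇ R i l))))
  symTrans = ∧-snd {allFin N (λ i → R i i)} t

IsEquiv-restrict : {m N : ℕ} {G : Rel N N} (A : Rel m m) (f : Fin m → Fin N) →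
  (∀ i j → A i j ≡ G (f i) (f j)) → IsEquiv G → IsEquiv A
IsEquiv-restrict A f e eqG = record
  { reflexive  = λ i → T-back (e i i) (reflexive (f i))
  ; symmetric  = λ i j u → T-back (e j i) (symmetric (f i) (f j) (subst T (e i j) u))
  ; transitive = λ i j l u v → T-back (e i l)
      (transitive (f i) (f j) (f l) (subst T (e i j) u) (subst T (e j l) v))
  }
  where open IsEquiv eqG

colourOf : (p : ℕ) → (Fin p → ℕ) → {N : ℕ} → Fin N → Maybe (Fin p)
colourOf p r i = colour p r (toℕ i)

Admissible : (p : ℕ) → (Fin p → ℕ) → {N : ℕ} → Rel N N → Set
Admissible p r R = ∀ i j → T (R i j) → T (sameColourOrFree (colourOf p r i) (colourOf p r j))

admissible-complete : (p : ℕ) (r : Fin p → ℕ) (N : ℕ) (R : Rel N N) → Admissible p r R → T (admissible p r N R)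
admissible-complete p r N R h = allFin-intro N (λ i → allFin-intro N (λ j → ⇒-intro (h i j)))

admissible-sound : (p : ℕ) (r : Fin p → ℕ) (N : ℕ) (R : Rel N N) → T (admissible p r N R) → Admissible p r R
admissible-sound p r N R t i j = ⇒-elim (allFin-elim N (allFin-elim N t i) j)

leader : {N : ℕ} → Rel N N → Fin N → Bool
leader {N} R i = allFin N (λ j → (toℕ j <ᵇ toℕ i) ⇒ᵇ not (R j i))

isEquivalence-ext : (N : ℕ) {R R′ : Rel N N} → R ≐ R′ → isEquivalence N R ≡ isEquivalence N R′
isEquivalence-ext N e = cong₂ _∧_ (allFin-cong N (λ i → e i i))
  (cong₂ _∧_ (allFin-cong N (λ i → allFin-cong N (λ j → ⇒-cong (e i j) (e j i))))
             (allFin-cong N (λ i → allFin-cong N (λ j → allFin-cong N (λ l →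
                ⇒-cong (cong₂ _∧_ (e i j) (e j l)) (e i l))))))

admissible-ext : (p : ℕ) (r : Fin p → ℕ) (N : ℕ) {R R′ : Rel N N} → R ≐ R′ →
  admissible p r N R ≡ admissible p r N R′
admissible-ext p r N e = allFin-cong N (λ i → allFin-cong N (λ j → ⇒-cong (e i j) refl))

numBlocks-ext : (N : ℕ) {R R′ : Rel N N} → R ≐ R′ → numBlocks N R ≡ numBlocks N R′
numBlocks-ext N e = sumFin-cong N (λ i → cong ⟦_⟧ (allFin-cong N (λ j → ⇒-cong refl (cong not (e j i)))))

mono : ℕ → Poly
mono m k = ⟦ m ≡ᵇ k ⟧

mono-degree : (m k : ℕ) → m * mono m k ≡ k * mono m k
mono-degree m k with T? (m ≡ᵇ k)
... | yes t = cong (_* mono m k) (≡ᵇ⇒≡ m k t)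
... | no ¬t = trans (cong (m *_) (⟦false⟧ ¬t)) (trans (*-zeroʳ m) (sym (trans (cong (k *_) (⟦false⟧ ¬t)) (*-zeroʳ k))))

λe⁻ᵏDeᵏ-mono : (m k : ℕ) → λe⁻ᵏDeᵏ (mono m) k ≡ mono (suc m) k + m * mono m k
λe⁻ᵏDeᵏ-mono m zero    = sym (mono-degree m 0)
λe⁻ᵏDeᵏ-mono m (suc k) = cong (mono m k +_) (sym (mono-degree m (suc k)))

λe⁻ᵏDeᵏ-cong : {f g : Poly} → (∀ j → f j ≡ g j) → (k : ℕ) → λe⁻ᵏDeᵏ f k ≡ λe⁻ᵏDeᵏ g k
λe⁻ᵏDeᵏ-cong e zero    = refl
λe⁻ᵏDeᵏ-cong e (suc k) = cong₂ _+_ (e k) (cong (suc k *_) (e (suc k)))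

λe⁻ᵏDeᵏ-scale : (c : ℕ) (f : Poly) (k : ℕ) → c * λe⁻ᵏDeᵏ f k ≡ λe⁻ᵏDeᵏ (λ j → c * f j) k
λe⁻ᵏDeᵏ-scale c f zero    = *-zeroʳ c
λe⁻ᵏDeᵏ-scale c f (suc k) = begin
  c * (f k + suc k * f (suc k))       ≡⟨ *-distribˡ-+ c (f k) _ ⟩
  c * f k + c * (suc k * f (suc k))   ≡⟨ cong (c * f k +_) (*-swapˡ c (suc k) (f (suc k))) ⟩
  c * f k + suc k * (c * f (suc k))   ∎

λe⁻ᵏDeᵏ-∑ : {A : Set} (xs : List A) (f : A → Poly) (k : ℕ) →
  ∑ xs (λ x → λe⁻ᵏDeᵏ (f x) k) ≡ λe⁻ᵏDeᵏ (λ j → ∑ xs (λ x → f x j)) k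
λe⁻ᵏDeᵏ-∑ xs f zero    = ∑-0 xs
λe⁻ᵏDeᵏ-∑ xs f (suc k) =
  trans (∑-+ xs _ _) (cong (∑ xs (λ x → f x k) +_) (∑-*ˡ xs (suc k) (λ x → f x (suc k))))

*ₚ-mono : (a b k : ℕ) → (mono a *ₚ mono b) k ≡ mono (a + b) k
*ₚ-mono zero    b k       = trans (cong₂ _+_ (+-identityʳ (mono b k)) (sumFin-0 k)) (+-identityʳ _)
*ₚ-mono (suc a) b zero    = refl
*ₚ-mono (suc a) b (suc k) = *ₚ-mono a b k

*ₚ-cong : {f f′ g g′ : Poly} → (∀ j → f j ≡ f′ j) → (∀ j → g j ≡ g′ j) → (k : ℕ) →
  (f *ₚ g) k ≡ (f′ *ₚ g′) k
*ₚ-cong {f} {f′} {g} {g′} ef eg k =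
  sumFin-cong (suc k) {λ i → f (toℕ i) * g (k ∸ toℕ i)} {λ i → f′ (toℕ i) * g′ (k ∸ toℕ i)}
    (λ i → cong₂ _*_ (ef (toℕ i)) (eg (k ∸ toℕ i)))

*ₚ-scale : (c d : ℕ) (f g : Poly) (k : ℕ) →
  ((λ j → c * f j) *ₚ (λ j → d * g j)) k ≡ c * d * (f *ₚ g) k
*ₚ-scale c d f g k =
  trans (sumFin-cong (suc k) {g = λ i → c * d * (f (toℕ i) * g (k ∸ toℕ i))}
                     (λ i → *-interchange c (f (toℕ i)) d (g (k ∸ toℕ i))))
        (sumFin-*ˡ (suc k) (c * d) (λ i → f (toℕ i) * g (k ∸ toℕ i)))

*ₚ-∑ : {A B : Set} (xs : List A) (ys : List B) (f : A → Poly) (g : B → Poly) (k : ℕ) →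
  ∑ xs (λ x → ∑ ys (λ y → (f x *ₚ g y) k)) ≡
  ((λ j → ∑ xs (λ x → f x j)) *ₚ (λ j → ∑ ys (λ y → g y j))) k
*ₚ-∑ xs ys f g k = begin
  ∑ xs (λ x → ∑ ys (λ y → sumFin (suc k) (λ i → f x (toℕ i) * g y (k ∸ toℕ i))))
    ≡⟨ ∑-cong xs (λ x → ∑-sumFin ys (suc k) (λ y i → f x (toℕ i) * g y (k ∸ toℕ i))) ⟩
  ∑ xs (λ x → sumFin (suc k) (λ i → ∑ ys (λ y → f x (toℕ i) * g y (k ∸ toℕ i))))
    ≡⟨ ∑-sumFin xs (suc k) (λ x i → ∑ ys (λ y → f x (toℕ i) * g y (k ∸ toℕ i))) ⟩
  sumFin (suc k) (λ i → ∑ xs (λ x → ∑ ys (λ y → f x (toℕ i) * g y (k ∸ toℕ i))))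
    ≡⟨ sumFin-cong (suc k) {g = λ i → ∑ xs (λ x → f x (toℕ i)) * ∑ ys (λ y → g y (k ∸ toℕ i))}
         (λ i → trans (∑-cong xs (λ x → ∑-*ˡ ys (f x (toℕ i)) _))
                                         (∑-*ʳ xs _ (λ x → f x (toℕ i)))) ⟩
  sumFin (suc k) (λ i → ∑ xs (λ x → f x (toℕ i)) * ∑ ys (λ y → g y (k ∸ toℕ i))) ∎

-- The functions built by the enumeration agree with the expected ones only
-- pointwise (there is no function extensionality), so summands are required to
-- respect pointwise ≈, a reflexive relation on A (≡ on Bool, and pointwise ≡ on
-- the rows of a relation).
module Enumeration {A : Set} (_≈_ : A → A → Set) (≈-refl : ∀ {x} → x ≈ x) where

  Respects : {n : ℕ} → ((Fin n → A) → ℕ) → Set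
  Respects F = ∀ {f g} → (∀ i → f i ≈ g i) → F f ≡ F g

  ++-respectsˡ : {a b : ℕ} {f g : Fin a → A} (h : Fin b → A) →
    (∀ i → f i ≈ g i) → ∀ x → (f ++ᵥ h) x ≈ (g ++ᵥ h) x
  ++-respectsˡ {a} {b} {f} {g} h e x = onSplit (splitAt a x)
    where
    onSplit : (s : Fin a ⊎ Fin b) → [ f , h ] s ≈ [ g , h ] s
    onSplit (inj₁ i) = e i
    onSplit (inj₂ j) = ≈-refl

  ++-respectsʳ : {a b : ℕ} (f : Fin a → A) {g h : Fin b → A} →
    (∀ i → g i ≈ h i) → ∀ x → (f ++ᵥ g) x ≈ (f ++ᵥ h) x
  ++-respectsʳ {a} {b} f {g} {h} e x = onSplit (splitAt a x)
    where
    onSplit : (s : Fin a ⊎ Fin b) → [ f , g ] s ≈ [ f , h ] s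
    onSplit (inj₁ i) = ≈-refl
    onSplit (inj₂ j) = e j

  ∑-funs-suc : (xs : List A) (n : ℕ) (F : (Fin (suc n) → A) → ℕ) → Respects F →
    ∑ (allFunsOf xs (suc n)) F ≡ ∑ xs (λ x → ∑ (allFunsOf xs n) (λ f → F (x ◂ f)))
  ∑-funs-suc xs n F resp = trans (∑-concatMap _ xs F) (∑-cong xs (λ x →
    trans (∑-map _ (allFunsOf xs n) F)
          (∑-cong (allFunsOf xs n) (λ f → resp (λ { zero → ≈-refl ; (suc i) → ≈-refl })))))

  ∑-funs-++ : (xs : List A) (a b : ℕ) (F : (Fin (a + b) → A) → ℕ) → Respects F →
    ∑ (allFunsOf xs (a + b)) F ≡ ∑ (allFunsOf xs a) (λ g → ∑ (allFunsOf xs b) (λ h → F (g ++ᵥ h)))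
  ∑-funs-++ xs zero    b F resp = sym (+-identityʳ _)
  ∑-funs-++ xs (suc a) b F resp = begin
    ∑ (allFunsOf xs (suc (a + b))) F
      ≡⟨ ∑-funs-suc xs (a + b) F resp ⟩
    ∑ xs (λ x → ∑ (allFunsOf xs (a + b)) (λ f → F (x ◂ f)))
      ≡⟨ ∑-cong xs (λ x → ∑-funs-++ xs a b (λ f → F (x ◂ f))
           (λ e → resp (λ { zero → ≈-refl ; (suc i) → e i }))) ⟩
    ∑ xs (λ x → ∑ (allFunsOf xs a) (λ g → ∑ (allFunsOf xs b) (λ h → F (x ◂ (g ++ᵥ h)))))
      ≡⟨ ∑-cong xs (λ x → ∑-cong (allFunsOf xs a) (λ g → ∑-cong (allFunsOf xs b) (λ h →
           resp (cons-++ x g h)))) ⟩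
    ∑ xs (λ x → ∑ (allFunsOf xs a) (λ g → ∑ (allFunsOf xs b) (λ h → F ((x ◂ g) ++ᵥ h))))
      ≡⟨ sym (∑-funs-suc xs a _ (λ e → ∑-cong (allFunsOf xs b) (λ h → resp (++-respectsˡ h e)))) ⟩
    ∑ (allFunsOf xs (suc a)) (λ g → ∑ (allFunsOf xs b) (λ h → F (g ++ᵥ h))) ∎
    where
    cons-++ : ∀ x (g : Fin a → A) (h : Fin b → A) (i : Fin (suc (a + b))) → (x ◂ (g ++ᵥ h)) i ≈ ((x ◂ g) ++ᵥ h) i
    cons-++ x g h zero    = ≈-refl
    cons-++ x g h (suc i) = onSplit (splitAt a i)
      where
      onSplit : (s : Fin a ⊎ Fin b) → [ g , h ] s ≈ [ x ◂ g , h ] (Data.Sum.map₁ suc s)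
      onSplit (inj₁ j) = ≈-refl
      onSplit (inj₂ j) = ≈-refl

module Pointwise {A B C : Set} (_≈_ : A → A → Set) (≈-refl : ∀ {x} → x ≈ x)
  (xs : List A) (ys : List B) (zs : List C) (_⊕_ : B → C → A)
  (decompose : ∀ (G : A → ℕ) → (∀ {x y} → x ≈ y → G x ≡ G y) →
               ∑ xs G ≡ ∑ ys (λ y → ∑ zs (λ z → G (y ⊕ z)))) where

  open Enumeration _≈_ ≈-refl using (Respects; ∑-funs-suc)
  open Enumeration {B} _≡_ refl using () renaming (∑-funs-suc to ∑-funs-sucᴮ)
  open Enumeration {C} _≡_ refl using () renaming (∑-funs-suc to ∑-funs-sucᶜ)

  ≡⇒≈ : ∀ {y y′ z z′} → y ≡ y′ → z ≡ z′ → (y ⊕ z) ≈ (y′ ⊕ z′)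
  ≡⇒≈ refl refl = ≈-refl

  ∑-funs-pointwise : (m : ℕ) (F : (Fin m → A) → ℕ) → Respects F →
    ∑ (allFunsOf xs m) F ≡ ∑ (allFunsOf ys m) (λ g → ∑ (allFunsOf zs m) (λ h → F (λ i → g i ⊕ h i)))
  ∑-funs-pointwise zero    F resp =
    trans (+-identityʳ _) (sym (trans (+-identityʳ _) (trans (+-identityʳ _) (resp (λ ())))))
  ∑-funs-pointwise (suc m) F resp = begin
    ∑ (allFunsOf xs (suc m)) F
      ≡⟨ ∑-funs-suc xs m F resp ⟩
    ∑ xs (λ x → ∑ (allFunsOf xs m) (λ f → F (x ◂ f)))
      ≡⟨ decompose _ (λ e → ∑-cong (allFunsOf xs m) (λ f → resp (λ { zero → e ; (suc i) → ≈-refl }))) ⟩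
    ∑ ys (λ y → ∑ zs (λ z → ∑ (allFunsOf xs m) (λ f → F ((y ⊕ z) ◂ f))))
      ≡⟨ ∑-cong ys (λ y → ∑-cong zs (λ z →
           ∑-funs-pointwise m _ (λ e → resp (λ { zero → ≈-refl ; (suc i) → e i })))) ⟩
    ∑ ys (λ y → ∑ zs (λ z → ∑ (allFunsOf ys m) (λ g → ∑ (allFunsOf zs m) (λ h →
      F ((y ⊕ z) ◂ (λ i → g i ⊕ h i))))))
      ≡⟨ ∑-cong ys (λ y → ∑-swap zs (allFunsOf ys m) _) ⟩
    ∑ ys (λ y → ∑ (allFunsOf ys m) (λ g → ∑ zs (λ z → ∑ (allFunsOf zs m) (λ h →
      F ((y ⊕ z) ◂ (λ i → g i ⊕ h i))))))
      ≡⟨ ∑-cong ys (λ y → ∑-cong (allFunsOf ys m) (λ g → ∑-cong zs (λ z → ∑-cong (allFunsOf zs m) (λ h →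
           resp (λ { zero → ≈-refl ; (suc i) → ≈-refl }))))) ⟩
    ∑ ys (λ y → ∑ (allFunsOf ys m) (λ g → ∑ zs (λ z → ∑ (allFunsOf zs m) (λ h →
      F (λ i → (y ◂ g) i ⊕ (z ◂ h) i)))))
      ≡⟨ ∑-cong ys (λ y → ∑-cong (allFunsOf ys m) (λ g → sym (∑-funs-sucᶜ zs m _
           (λ e → resp (λ { zero → ≡⇒≈ refl (e zero) ; (suc i) → ≡⇒≈ refl (e (suc i)) }))))) ⟩
    ∑ ys (λ y → ∑ (allFunsOf ys m) (λ g → ∑ (allFunsOf zs (suc m)) (λ h → F (λ i → (y ◂ g) i ⊕ h i))))
      ≡⟨ sym (∑-funs-sucᴮ ys m _ (λ e → ∑-cong (allFunsOf zs (suc m)) (λ h → resp (λ i → ≡⇒≈ (e i) refl)))) ⟩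
    ∑ (allFunsOf ys (suc m)) (λ g → ∑ (allFunsOf zs (suc m)) (λ h → F (λ i → g i ⊕ h i))) ∎

bools : List Bool
bools = true ∷ false ∷ []

allRel : (m n : ℕ) → List (Rel m n)
allRel m n = allFunsOf (allFunsOf bools n) m

glue : {a b : ℕ} → Rel a a → Rel a b → Rel b a → Rel b b → Rel (a + b) (a + b)
glue A B C D = (λ i → A i ++ᵥ B i) ++ᵥ (λ i → C i ++ᵥ D i)

module Blocks {a b : ℕ} (A : Rel a a) (B : Rel a b) (C : Rel b a) (D : Rel b b) where
  G : Rel (a + b) (a + b)
  G = glue A B C D

  upperRows : Fin a → Fin (a + b) → Bool
  upperRows i = A i ++ᵥ B i

  lowerRows : Fin b → Fin (a + b) → Bool
  lowerRows i = C i ++ᵥ D i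

  o : Fin a → Fin (a + b)
  o i = i ↑ˡ b

  ν : Fin b → Fin (a + b)
  ν j = a ↑ʳ j

  entry-A : ∀ i j → G (o i) (o j) ≡ A i j
  entry-A i j = trans (cong (λ row → row (o j)) (lookup-++ˡ upperRows lowerRows i)) (lookup-++ˡ (A i) (B i) j)

  entry-B : ∀ i j → G (o i) (ν j) ≡ B i j
  entry-B i j = trans (cong (λ row → row (ν j)) (lookup-++ˡ upperRows lowerRows i)) (lookup-++ʳ (A i) (B i) j)

  entry-C : ∀ i j → G (ν i) (o j) ≡ C i j
  entry-C i j = trans (cong (λ row → row (o j)) (lookup-++ʳ upperRows lowerRows i)) (lookup-++ˡ (C i) (D i) j)

  entry-D : ∀ i j → G (ν i) (ν j) ≡ D i j
  entry-D i j = trans (cong (λ row → row (ν j)) (lookup-++ʳ upperRows lowerRows i)) (lookup-++ʳ (C i) (D i) j)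

data Half (a b : ℕ) : Fin (a + b) → Set where
  left  : (i : Fin a) → Half a b (i ↑ˡ b)
  right : (j : Fin b) → Half a b (a ↑ʳ j)

half : (a b : ℕ) (x : Fin (a + b)) → Half a b x
half zero    b x       = right x
half (suc a) b zero    = left zero
half (suc a) b (suc x) with half a b x
... | left i  = left (suc i)
... | right j = right j

∑-rel-blocks : (a b : ℕ) (F : Rel (a + b) (a + b) → ℕ) → (∀ {R R′} → R ≐ R′ → F R ≡ F R′) →
  ∑ (allRel (a + b) (a + b)) F ≡
  ∑ (allRel a a) (λ A → ∑ (allRel a b) (λ B → ∑ (allRel b a) (λ C → ∑ (allRel b b) (λ D → F (glue A B C D)))))
∑-rel-blocks a b F resp = begin
  ∑ (allRel (a + b) (a + b)) F
    ≡⟨ ∑-funs-++ rows a b F resp ⟩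
  ∑ (allFunsOf rows a) (λ U → ∑ (allFunsOf rows b) (λ L → F (U ++ᵥ L)))
    ≡⟨ ∑-funs-pointwise a _ (λ e → ∑-cong (allFunsOf rows b) (λ L → resp (++-respectsˡ L e))) ⟩
  ∑ (allRel a a) (λ A → ∑ (allRel a b) (λ B → ∑ (allFunsOf rows b) (λ L → F ((λ i → A i ++ᵥ B i) ++ᵥ L))))
    ≡⟨ ∑-cong (allRel a a) (λ A → ∑-cong (allRel a b) (λ B →
         ∑-funs-pointwise b _ (λ e → resp (++-respectsʳ (λ i → A i ++ᵥ B i) e)))) ⟩
  ∑ (allRel a a) (λ A → ∑ (allRel a b) (λ B → ∑ (allRel b a) (λ C → ∑ (allRel b b) (λ D → F (glue A B C D))))) ∎
  where
  rows : List (Fin (a + b) → Bool)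
  rows = allFunsOf bools (a + b)
  open Enumeration {Fin (a + b) → Bool} (λ f g → ∀ j → f j ≡ g j) (λ _ → refl)
  open Pointwise (λ f g → ∀ j → f j ≡ g j) (λ _ → refl) rows (allFunsOf bools a) (allFunsOf bools b) _++ᵥ_
    (Enumeration.∑-funs-++ _≡_ refl bools a b)

<ᵇ-+ˡ : (a m n : ℕ) → (a + m <ᵇ a + n) ≡ (m <ᵇ n)
<ᵇ-+ˡ zero    m n = refl
<ᵇ-+ˡ (suc a) m n = <ᵇ-+ˡ a m n

module BlockLeaders {a b : ℕ} (A : Rel a a) (B : Rel a b) (C : Rel b a) (D : Rel b b) where
  open Blocks A B C D

  -- Nothing in the lower half precedes the upper half, so leaders there are those of A.
  leader-upper : ∀ i → leader G (o i) ≡ leader A i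
  leader-upper i = trans (allFin-split a b _) (trans (cong₂ _∧_ upperPart lowerPart) (∧-identityʳ _))
    where
    upperPart : allFin a (λ j → (toℕ (o j) <ᵇ toℕ (o i)) ⇒ᵇ not (G (o j) (o i))) ≡ leader A i
    upperPart = allFin-cong a (λ j → ⇒-cong (cong₂ _<ᵇ_ (toℕ-↑ˡ j b) (toℕ-↑ˡ i b)) (cong not (entry-A j i)))
    lowerPart : allFin b (λ j → (toℕ (ν j) <ᵇ toℕ (o i)) ⇒ᵇ not (G (ν j) (o i))) ≡ true
    lowerPart = T⇒≡true (allFin-intro b (λ j → ⇒-intro (λ lt → ⊥-elim (<-irrefl refl
      (<-≤-trans (subst₂ _<_ (toℕ-↑ʳ a j) (toℕ-↑ˡ i b) (<ᵇ⇒< _ _ lt))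
                 (≤-trans (<⇒≤ (toℕ<n i)) (m≤m+n a (toℕ j))))))))

  leader-lower : ∀ j → leader G (ν j) ≡ allFin a (λ i → not (B i j)) ∧ leader D j
  leader-lower j = trans (allFin-split a b _) (cong₂ _∧_ upperPart lowerPart)
    where
    upperPart : allFin a (λ i → (toℕ (o i) <ᵇ toℕ (ν j)) ⇒ᵇ not (G (o i) (ν j))) ≡ allFin a (λ i → not (B i j))
    upperPart = allFin-cong a (λ i → ⇒-cong (T⇒≡true (<⇒<ᵇ (subst₂ _<_ (sym (toℕ-↑ˡ i b)) (sym (toℕ-↑ʳ a j))
                                                          (<-≤-trans (toℕ<n i) (m≤m+n a (toℕ j))))))
                                            (cong not (entry-B i j)))
    lowerPart : allFin b (λ k → (toℕ (ν k) <ᵇ toℕ (ν j)) ⇒ᵇ not (G (ν k) (ν j))) ≡ leader D j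
    lowerPart = allFin-cong b (λ k →
      ⇒-cong (trans (cong₂ _<ᵇ_ (toℕ-↑ʳ a k) (toℕ-↑ʳ a j)) (<ᵇ-+ˡ a (toℕ k) (toℕ j)))
                                            (cong not (entry-D k j)))

  numBlocks-glue : numBlocks (a + b) G ≡ numBlocks a A + sumFin b (λ j → ⟦ allFin a (λ i → not (B i j)) ∧ leader D j ⟧)
  numBlocks-glue = trans (sumFin-split a b _)
    (cong₂ _+_ (sumFin-cong a (λ i → cong ⟦_⟧ (leader-upper i))) (sumFin-cong b (λ j → cong ⟦_⟧ (leader-lower j))))

∑-uniqueChoice : {A : Set} (xs : List A) (n : ℕ) (Q : Fin n → A → Bool) →
  (∀ i → ∑ xs (λ x → ⟦ Q i x ⟧) ≡ 1) →
  ∑ (allFunsOf xs n) (λ f → ⟦ allFin n (λ i → Q i (f i)) ⟧) ≡ 1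
∑-uniqueChoice xs zero    Q h = refl
∑-uniqueChoice xs (suc n) Q h = begin
  ∑ (allFunsOf xs (suc n)) (λ f → ⟦ allFin (suc n) (λ i → Q i (f i)) ⟧)
    ≡⟨ ∑-concatMap _ xs _ ⟩
  ∑ xs (λ x → ∑ (map _ (allFunsOf xs n)) (λ f → ⟦ allFin (suc n) (λ i → Q i (f i)) ⟧))
    ≡⟨ ∑-cong xs (λ x → ∑-map _ (allFunsOf xs n) _) ⟩
  ∑ xs (λ x → ∑ (allFunsOf xs n) (λ f → ⟦ Q zero x ∧ allFin n (λ i → Q (suc i) (f i)) ⟧))
    ≡⟨ ∑-cong xs (λ x → trans (∑-cong (allFunsOf xs n) (λ f → ⟦∧⟧ (Q zero x) _))
                              (∑-*ˡ (allFunsOf xs n) ⟦ Q zero x ⟧ _)) ⟩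
  ∑ xs (λ x → ⟦ Q zero x ⟧ * ∑ (allFunsOf xs n) (λ f → ⟦ allFin n (λ i → Q (suc i) (f i)) ⟧))
    ≡⟨ ∑-cong xs (λ x → cong (⟦ Q zero x ⟧ *_) (∑-uniqueChoice xs n (λ i → Q (suc i)) (λ i → h (suc i)))) ⟩
  ∑ xs (λ x → ⟦ Q zero x ⟧ * 1)
    ≡⟨ trans (∑-cong xs (λ x → *-identityʳ _)) (h zero) ⟩
  1 ∎

emptyRel : {m n : ℕ} → Rel m n → Bool
emptyRel {m} {n} B = allFin m (λ i → allFin n (λ j → not (B i j)))

emptyRel-intro : {m n : ℕ} {B : Rel m n} → (∀ i j → ¬ T (B i j)) → T (emptyRel B)
emptyRel-intro {m} {n} none = allFin-intro m (λ i → allFin-intro n (λ j → not-intro (none i j)))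

emptyRel-elim : {m n : ℕ} {B : Rel m n} → T (emptyRel B) → ∀ i j → ¬ T (B i j)
emptyRel-elim {m} {n} t i j = not-elim (allFin-elim n (allFin-elim m t i) j)

∑-emptyRel : (m n : ℕ) → ∑ (allRel m n) (λ B → ⟦ emptyRel B ⟧) ≡ 1
∑-emptyRel m n = ∑-uniqueChoice (allFunsOf bools n) m (λ _ row → allFin n (λ j → not (row j)))
  (λ _ → ∑-uniqueChoice bools n (λ _ b → not b) (λ _ → refl))

∑-emptyRel-* : (m n Z : ℕ) → ∑ (allRel m n) (λ B → ⟦ emptyRel B ⟧ * Z) ≡ Z
∑-emptyRel-* m n Z =
  trans (∑-*ʳ (allRel m n) Z (λ B → ⟦ emptyRel B ⟧)) (trans (cong (_* Z) (∑-emptyRel m n)) (*-identityˡ Z))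

column : {M : ℕ} → Rel M 1 → (Fin M → Bool) → Bool
column {M} c x = allFin M (λ j → agree (c j zero) (x j))

row : {M : ℕ} → Rel 1 M → (Fin M → Bool) → Bool
row {M} d x = allFin M (λ j → agree (d zero j) (x j))

∑-column : (M : ℕ) (x : Fin M → Bool) → ∑ (allRel M 1) (λ c → ⟦ column c x ⟧) ≡ 1
∑-column M x = ∑-uniqueChoice (allFunsOf bools 1) M (λ j cell → agree (cell zero) (x j)) (λ j → singleEntry (x j))
  where
  singleEntry : ∀ y → ∑ (allFunsOf bools 1) (λ cell → ⟦ agree (cell zero) y ⟧) ≡ 1
  singleEntry true  = refl
  singleEntry false = refl

∑-row : (M : ℕ) (x : Fin M → Bool) → ∑ (allRel 1 M) (λ d → ⟦ row d x ⟧) ≡ 1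
∑-row M x = trans (∑-cong (allRel 1 M) (λ d → cong ⟦_⟧ (sym (∧-identityʳ (row d x)))))
  (∑-uniqueChoice (allFunsOf bools M) 1 (λ _ cells → allFin M (λ j → agree (cells j) (x j)))
    (λ _ → ∑-uniqueChoice bools M (λ j b → agree b (x j)) (λ j → singleEntry (x j))))
  where
  singleEntry : ∀ y → ∑ bools (λ b → ⟦ agree b y ⟧) ≡ 1
  singleEntry true  = refl
  singleEntry false = refl

∑-entry : (Z : ℕ) → ∑ (allRel 1 1) (λ e → ⟦ e zero zero ⟧ * Z) ≡ Z
∑-entry Z = trans (∑-*ʳ (allRel 1 1) Z (λ e → ⟦ e zero zero ⟧)) (+-identityʳ Z)

weight : (p : ℕ) → (Fin p → ℕ) → (N : ℕ) → Rel N N → Poly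
weight p r N R k = ⟦ isEquivalence N R ∧ admissible p r N R ⟧ * mono (numBlocks N R) k

KStirling-∑ : (p : ℕ) (r : Fin p → ℕ) (N k : ℕ) → KStirling p r N k ≡ ∑ (allRel N N) (λ R → weight p r N R k)
KStirling-∑ p r N k = trans (length-filter _ (allRelations N)) (∑-cong (allRel N N) (λ R →
  trans (cong ⟦_⟧ (sym (∧-assoc (isEquivalence N R) (admissible p r N R) _)))
        (⟦∧⟧ (isEquivalence N R ∧ admissible p r N R) (numBlocks N R ≡ᵇ k))))

weight-ext : (p : ℕ) (r : Fin p → ℕ) (N k : ℕ) {R R′ : Rel N N} → R ≐ R′ → weight p r N R k ≡ weight p r N R′ k
weight-ext p r N k e =
  cong₂ _*_ (cong ⟦_⟧ (cong₂ _∧_ (isEquivalence-ext N e) (admissible-ext p r N e))) (cong (λ m → mono m k) (numBlocks-ext N e))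

least : (n : ℕ) (Q : Fin n → Bool) (i₀ : Fin n) → T (Q i₀) →
  Σ (Fin n) (λ m → T (Q m) × (∀ j → toℕ j < toℕ m → ¬ T (Q j)))
least (suc n) Q i₀ q with T? (Q zero)
... | yes q₀ = zero , q₀ , (λ j ())
least (suc n) Q zero     q | no ¬q₀ = ⊥-elim (¬q₀ q)
least (suc n) Q (suc i₀) q | no ¬q₀ with least n (λ i → Q (suc i)) i₀ q
... | m , qm , below = suc m , qm , earlier
  where
  earlier : ∀ j → toℕ j < toℕ (suc m) → ¬ T (Q j)
  earlier zero    _         = ¬q₀
  earlier (suc j) (s≤s j<m) = below j j<m

module Leaders {M : ℕ} {R : Rel M M} (eqR : IsEquiv R) where
  open IsEquiv eqR

  leader-exists : (i : Fin M) → Σ (Fin M) (λ m → T (leader R m) × T (R m i))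
  leader-exists i with least M (λ m → R m i) i (reflexive i)
  ... | m , Rmi , below = m , isLeader , Rmi
    where
    isLeader : T (leader R m)
    isLeader = allFin-intro M (λ j → ⇒-intro (λ j<m → not-intro (λ Rjm →
      below j (<ᵇ⇒< _ _ j<m) (transitive j m i Rjm Rmi))))

  leaders-unique : ∀ {i m} → T (leader R i) → T (leader R m) → T (R i m) → i ≡ m
  leaders-unique {i} {m} li lm Rim with <-cmp (toℕ i) (toℕ m)
  ... | tri< i<m _ _ = ⊥-elim (not-elim (⇒-elim (allFin-elim M lm i) (<⇒<ᵇ i<m)) Rim)
  ... | tri≈ _ i≡m _ = toℕ-injective i≡m
  ... | tri> _ _ m<i = ⊥-elim (not-elim (⇒-elim (allFin-elim M li m) (<⇒<ᵇ m<i)) (symmetric i m Rim))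

emptyColumn : {M : ℕ} → Rel M 1 → Bool
emptyColumn c = column c (λ _ → false)

-- The number of blocks of R whose leader's row is the column c: it is 1 if c is
-- (the indicator of) a class of R, and 0 otherwise.
classMatches : {M : ℕ} → Rel M M → Rel M 1 → ℕ
classMatches {M} R c = sumFin M (λ i → ⟦ leader R i ⟧ * ⟦ column c (R i) ⟧)

-- Each block is matched by exactly one column, so summing over columns counts blocks.
∑-classMatches : {M : ℕ} (R : Rel M M) → ∑ (allRel M 1) (classMatches R) ≡ numBlocks M R
∑-classMatches {M} R = begin
  ∑ (allRel M 1) (λ c → sumFin M (λ i → ⟦ leader R i ⟧ * ⟦ column c (R i) ⟧))
    ≡⟨ ∑-sumFin (allRel M 1) M _ ⟩
  sumFin M (λ i → ∑ (allRel M 1) (λ c → ⟦ leader R i ⟧ * ⟦ column c (R i) ⟧))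
    ≡⟨ sumFin-cong M (λ i → trans (∑-*ˡ (allRel M 1) ⟦ leader R i ⟧ (λ c → ⟦ column c (R i) ⟧))
                                  (trans (cong (⟦ leader R i ⟧ *_) (∑-column M (R i))) (*-identityʳ _))) ⟩
  sumFin M (λ i → ⟦ leader R i ⟧) ∎

module ClassMatches {M : ℕ} {R : Rel M M} (eqR : IsEquiv R) (c : Rel M 1) where
  open IsEquiv eqR
  open Leaders eqR

  classMatches-none : (∀ i → ¬ T (column c (R i))) → classMatches R c ≡ 0
  classMatches-none none = trans (sumFin-cong M (λ i →
    trans (cong (⟦ leader R i ⟧ *_) (⟦false⟧ (none i))) (*-zeroʳ ⟦ leader R i ⟧))) (sumFin-0 M)

  classMatches-empty : T (emptyColumn c) → classMatches R c ≡ 0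
  classMatches-empty empty = classMatches-none (λ i col →
    not-elim (allFin-elim M empty i) (T-back (agree-sound (allFin-elim M col i)) (reflexive i)))

  classMatches-class : (i₀ : Fin M) → (∀ j → c j zero ≡ R i₀ j) → classMatches R c ≡ 1
  classMatches-class i₀ isClass with leader-exists i₀
  ... | m , leads , Rmi₀ = sumFin-unique M _ m (cong₂ _*_ (⟦true⟧ leads) (⟦true⟧ matches)) others
    where
    rowOf : ∀ {i} → T (R i₀ i) → ∀ j → c j zero ≡ R i j
    rowOf {i} R₀i j = trans (isClass j) (bool-ext (transitive i (i₀) j (symmetric i₀ i R₀i))
                                              (transitive i₀ i j R₀i))
    matches : T (column c (R m))
    matches = allFin-intro M (λ j → agree-complete (rowOf (symmetric m i₀ Rmi₀) j))
    others : ∀ i → i ≢ m → ⟦ leader R i ⟧ * ⟦ column c (R i) ⟧ ≡ 0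
    others i i≢m with T? (leader R i) | T? (column c (R i))
    ... | no ¬li | _      = cong (_* ⟦ column c (R i) ⟧) (⟦false⟧ ¬li)
    ... | yes li | no ¬ci = trans (cong (⟦ leader R i ⟧ *_) (⟦false⟧ ¬ci)) (*-zeroʳ ⟦ leader R i ⟧)
    ... | yes li | yes ci = ⊥-elim (i≢m (leaders-unique li leads Rim))
      where
      Rim : T (R i m)
      Rim = subst T (trans (sym (rowOf (symmetric m i₀ Rmi₀) m)) (agree-sound (allFin-elim M ci m)))
                    (reflexive m)

T-of-¬not : {a : Bool} → ¬ T (not a) → T a
T-of-¬not {true}  _ = _
T-of-¬not {false} h = h _

sameColourOrFree-free : {p : ℕ} (x : Maybe (Fin p)) → T (sameColourOrFree x nothing)
sameColourOrFree-free (just x) = _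
sameColourOrFree-free nothing  = _

module Adjoin {M : ℕ} (R : Rel M M) (c : Rel M 1) (d : Rel 1 M) (e : Rel 1 1) where
  open Blocks R c d e
  open BlockLeaders R c d e using (numBlocks-glue)

  numBlocks-adjoin : numBlocks (M + 1) G ≡ numBlocks M R + ⟦ emptyColumn c ⟧
  numBlocks-adjoin =
    trans numBlocks-glue (cong (numBlocks M R +_) (trans (+-identityʳ _) (cong ⟦_⟧ (∧-identityʳ _))))

  admissible-adjoin : (p : ℕ) (r : Fin p → ℕ) → colour p r M ≡ nothing →
    admissible p r (M + 1) G ≡ admissible p r M R
  admissible-adjoin p r uncoloured = bool-ext toOld toNew
    where
    colour-old : ∀ i → colourOf p r (o i) ≡ colourOf p r i
    colour-old i = cong (colour p r) (toℕ-↑ˡ i 1)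
    colour-new : colourOf p r (ν zero) ≡ nothing
    colour-new = trans (cong (colour p r) (trans (toℕ-↑ʳ M zero) (+-identityʳ M))) uncoloured
    toOld : T (admissible p r (M + 1) G) → T (admissible p r M R)
    toOld t = admissible-complete p r M R (λ i j u →
      subst T (cong₂ sameColourOrFree (colour-old i) (colour-old j))
        (admissible-sound p r (M + 1) G t (o i) (o j) (T-back (entry-A i j) u)))
    toNew : T (admissible p r M R) → T (admissible p r (M + 1) G)
    toNew t = admissible-complete p r (M + 1) G onHalves
      where
      onHalves : Admissible p r G
      onHalves x y u with half M 1 x | half M 1 y
      ... | left i | left j = T-back (cong₂ sameColourOrFree (colour-old i) (colour-old j))
                                (admissible-sound p r M R t i j (subst T (entry-A i j) u))
      ... | left i     | right zero = T-back (cong (sameColourOrFree (colourOf p r (o i))) colour-new)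
                                          (sameColourOrFree-free (colourOf p r (o i)))
      ... | right zero | left j     = T-back (cong (λ z → sameColourOrFree z (colourOf p r (o j))) colour-new) _
      ... | right zero | right zero = T-back (cong (λ z → sameColourOrFree z z) colour-new) _

  -- The support of the column c is R-linked and R-closed, i.e. empty or a single class of R.
  record ClassLike : Set where
    field
      linked : ∀ i j → T (c i zero) → T (c j zero) → T (R i j)
      closed : ∀ i j → T (c i zero) → T (R i j) → T (c j zero)

  ClassLike-empty : T (emptyColumn c) → ClassLike
  ClassLike-empty empty = record
    { linked = λ i j ci _ → ⊥-elim (not-elim (allFin-elim M empty i) ci)
    ; closed = λ i j ci _ → ⊥-elim (not-elim (allFin-elim M empty i) ci) }

  ClassLike-class : IsEquiv R → (i₀ : Fin M) → (∀ j → c j zero ≡ R i₀ j) → ClassLike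
  ClassLike-class eqR i₀ isClass = record
    { linked = λ i j ci cj → transitive i i₀ j (symmetric i₀ i (subst T (isClass i) ci)) (subst T (isClass j) cj)
    ; closed = λ i j ci Rij → T-back (isClass j) (transitive i₀ i j (subst T (isClass i) ci) Rij) }
    where open IsEquiv eqR

  module FromEquiv (eqG : IsEquiv G) where
    open IsEquiv eqG

    old-equiv : IsEquiv R
    old-equiv = IsEquiv-restrict R o (λ i j → sym (entry-A i j)) eqG

    new-reflexive : T (e zero zero)
    new-reflexive = subst T (entry-D zero zero) (reflexive (ν zero))

    new-symmetric : ∀ j → d zero j ≡ c j zero
    new-symmetric j = bool-ext
      (λ u → subst T (entry-B j zero) (symmetric (ν zero) (o j) (T-back (entry-C zero j) u)))
      (λ u → subst T (entry-C zero j) (symmetric (o j) (ν zero) (T-back (entry-B j zero) u)))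

    new-class : ∀ i₀ → T (c i₀ zero) → ∀ j → c j zero ≡ R i₀ j
    new-class i₀ ci₀ j = bool-ext
      (λ u → subst T (entry-A i₀ j) (transitive (o i₀) (ν zero) (o j) (T-back (entry-B i₀ zero) ci₀)
               (symmetric (o j) (ν zero) (T-back (entry-B j zero) u))))
      (λ u → subst T (entry-B j zero) (transitive (o j) (o i₀) (ν zero)
               (symmetric (o i₀) (o j) (T-back (entry-A i₀ j) u)) (T-back (entry-B i₀ zero) ci₀)))

  IsEquiv-adjoin : IsEquiv R → T (e zero zero) → (∀ j → d zero j ≡ c j zero) → ClassLike → IsEquiv G
  IsEquiv-adjoin eqR ee sym-dc cl = record { reflexive = refl′ ; symmetric = sym′ ; transitive = trans′ }
    where
    open IsEquiv eqR
    open ClassLike cl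
    dc : ∀ j → G (ν zero) (o j) ≡ c j zero
    dc j = trans (entry-C zero j) (sym-dc j)
    refl′ : ∀ x → T (G x x)
    refl′ x with half M 1 x
    ... | left i     = T-back (entry-A i i) (reflexive i)
    ... | right zero = T-back (entry-D zero zero) ee
    sym′ : ∀ x y → T (G x y) → T (G y x)
    sym′ x y u with half M 1 x | half M 1 y
    ... | left i     | left j     = T-back (entry-A j i) (symmetric i j (subst T (entry-A i j) u))
    ... | left i     | right zero = T-back (dc i) (subst T (entry-B i zero) u)
    ... | right zero | left j     = T-back (entry-B j zero) (subst T (dc j) u)
    ... | right zero | right zero = u
    trans′ : ∀ x y z → T (G x y) → T (G y z) → T (G x z)
    trans′ x y z u v with half M 1 x | half M 1 y | half M 1 z
    ... | left i | left j | left l =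
      T-back (entry-A i l) (transitive i j l (subst T (entry-A i j) u) (subst T (entry-A j l) v))
    ... | left i | left j | right zero =
      T-back (entry-B i zero) (closed j i (subst T (entry-B j zero) v) (symmetric i j (subst T (entry-A i j) u)))
    ... | left i | right zero | left l =
      T-back (entry-A i l) (linked i l (subst T (entry-B i zero) u) (subst T (dc l) v))
    ... | left i | right zero | right zero = u
    ... | right zero | left j | left l =
      T-back (dc l) (closed j l (subst T (dc j) u) (subst T (entry-A j l) v))
    ... | right zero | left j | right zero = T-back (entry-D zero zero) ee
    ... | right zero | right zero | left l = v
    ... | right zero | right zero | right zero = u

  -- G is an equivalence iff e, d and c satisfy the conditions above; counted:
  -- the new point forms its own block (empty column) or joins one block of R.
  isEquivalence-adjoin : IsEquiv R →
    ⟦ isEquivalence (M + 1) G ⟧ ≡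
    ⟦ e zero zero ⟧ * (⟦ row d (λ j → c j zero) ⟧ * (⟦ emptyColumn c ⟧ + classMatches R c))
  isEquivalence-adjoin eqR with T? (isEquivalence (M + 1) G)
  ... | yes tG = trans (⟦true⟧ tG) (sym (begin
      ⟦ e zero zero ⟧ * (⟦ row d (λ j → c j zero) ⟧ * (⟦ emptyColumn c ⟧ + classMatches R c))
        ≡⟨ cong₂ (λ x y → x * (y * (⟦ emptyColumn c ⟧ + classMatches R c))) (⟦true⟧ new-reflexive)
                 (⟦true⟧ (allFin-intro M (λ j → agree-complete (new-symmetric j)))) ⟩
      1 * (1 * (⟦ emptyColumn c ⟧ + classMatches R c))
        ≡⟨ trans (*-identityˡ _) (*-identityˡ _) ⟩
      ⟦ emptyColumn c ⟧ + classMatches R c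
        ≡⟨ oneChoice ⟩
      1 ∎))
    where
    open FromEquiv (isEquivalence-sound (M + 1) G tG)
    open ClassMatches eqR c
    oneChoice : ⟦ emptyColumn c ⟧ + classMatches R c ≡ 1
    oneChoice with T? (emptyColumn c)
    ... | yes empty = cong₂ _+_ (⟦true⟧ empty) (classMatches-empty empty)
    ... | no ¬empty with allFin-witness M _ ¬empty
    ...   | i₀ , ¬not-ci₀ = trans (cong (_+ classMatches R c) (⟦false⟧ ¬empty))
                                 (classMatches-class i₀ (new-class i₀ (T-of-¬not ¬not-ci₀)))
  ... | no ¬G = trans (⟦false⟧ ¬G) (sym noChoice)
    where
    open ClassMatches eqR c
    noChoice : ⟦ e zero zero ⟧ * (⟦ row d (λ j → c j zero) ⟧ * (⟦ emptyColumn c ⟧ + classMatches R c)) ≡ 0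
    noChoice with T? (e zero zero) | T? (row d (λ j → c j zero))
    ... | no ¬ee | _      = cong (_* _) (⟦false⟧ ¬ee)
    ... | yes ee | no ¬dc = trans (cong (λ x → ⟦ e zero zero ⟧ * (x * _)) (⟦false⟧ ¬dc)) (*-zeroʳ ⟦ e zero zero ⟧)
    ... | yes ee | yes dc = trans (cong (λ x → ⟦ e zero zero ⟧ * (⟦ row d (λ j → c j zero) ⟧ * x))
                                        (cong₂ _+_ (⟦false⟧ notEmpty) (classMatches-none notClass)))
                                  (trans (cong (⟦ e zero zero ⟧ *_) (*-zeroʳ ⟦ row d (λ j → c j zero) ⟧))
                                         (*-zeroʳ ⟦ e zero zero ⟧))
      where
      isEquivWith : ClassLike → IsEquiv G
      isEquivWith = IsEquiv-adjoin eqR ee (λ j → agree-sound (allFin-elim M dc j))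
      notEmpty : ¬ T (emptyColumn c)
      notEmpty empty = ¬G (isEquivalence-complete (M + 1) G (isEquivWith (ClassLike-empty empty)))
      notClass : ∀ i → ¬ T (column c (R i))
      notClass i col = ¬G (isEquivalence-complete (M + 1) G
        (isEquivWith (ClassLike-class eqR i (λ j → agree-sound (allFin-elim M col j)))))

  weight-adjoin : (p : ℕ) (r : Fin p → ℕ) → colour p r M ≡ nothing → IsEquiv R → (k : ℕ) →
    weight p r (M + 1) G k ≡
    ⟦ e zero zero ⟧ * (⟦ row d (λ j → c j zero) ⟧ * (⟦ admissible p r M R ⟧ *
      (⟦ emptyColumn c ⟧ * mono (suc (numBlocks M R)) k + classMatches R c * mono (numBlocks M R) k)))
  weight-adjoin p r uncoloured eqR k = begin
    ⟦ isEquivalence (M + 1) G ∧ admissible p r (M + 1) G ⟧ * mono (numBlocks (M + 1) G) k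
      ≡⟨ cong₂ _*_ (trans (⟦∧⟧ (isEquivalence (M + 1) G) (admissible p r (M + 1) G))
                          (cong₂ _*_ (isEquivalence-adjoin eqR) (cong ⟦_⟧ (admissible-adjoin p r uncoloured))))
                   (cong (λ m → mono m k) numBlocks-adjoin) ⟩
    ⟦ e zero zero ⟧ * (⟦ row d (λ j → c j zero) ⟧ * (⟦ emptyColumn c ⟧ + classMatches R c)) * ⟦ admissible p r M R ⟧
      * mono (nb + ⟦ emptyColumn c ⟧) k
      ≡⟨ rearrange ⟦ e zero zero ⟧ ⟦ row d (λ j → c j zero) ⟧ ⟦ emptyColumn c ⟧ (classMatches R c)
                   ⟦ admissible p r M R ⟧ _ ⟩
    ⟦ e zero zero ⟧ * (⟦ row d (λ j → c j zero) ⟧ * (⟦ admissible p r M R ⟧ *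
      ((⟦ emptyColumn c ⟧ + classMatches R c) * mono (nb + ⟦ emptyColumn c ⟧) k)))
      ≡⟨ cong (λ x → ⟦ e zero zero ⟧ * (⟦ row d (λ j → c j zero) ⟧ * (⟦ admissible p r M R ⟧ * x))) newBlockOrNot ⟩
    ⟦ e zero zero ⟧ * (⟦ row d (λ j → c j zero) ⟧ * (⟦ admissible p r M R ⟧ *
      (⟦ emptyColumn c ⟧ * mono (suc nb) k + classMatches R c * mono nb k))) ∎
    where
    nb : ℕ
    nb = numBlocks M R
    rearrange : ∀ a b x y z w → a * (b * (x + y)) * z * w ≡ a * (b * (z * ((x + y) * w)))
    rearrange = solve-∀
    -- An empty column adds a block and matches no class.
    newBlockOrNot : (⟦ emptyColumn c ⟧ + classMatches R c) * mono (nb + ⟦ emptyColumn c ⟧) k ≡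
                    ⟦ emptyColumn c ⟧ * mono (suc nb) k + classMatches R c * mono nb k
    newBlockOrNot with T? (emptyColumn c)
    ... | yes empty rewrite ⟦true⟧ empty | ClassMatches.classMatches-empty eqR c empty | +-comm nb 1 =
      sym (+-identityʳ _)
    ... | no ¬empty rewrite ⟦false⟧ ¬empty | +-identityʳ nb = refl

  weight-adjoin-¬equiv : (p : ℕ) (r : Fin p → ℕ) → ¬ T (isEquivalence M R) → (k : ℕ) → weight p r (M + 1) G k ≡ 0
  weight-adjoin-¬equiv p r ¬eqR k = cong (_* mono (numBlocks (M + 1) G) k) (⟦false⟧ (λ t →
    ¬eqR (isEquivalence-complete M R (FromEquiv.old-equiv (isEquivalence-sound (M + 1) G (∧-fst t))))))

colour-beyond : (p : ℕ) (r : Fin p → ℕ) (x : ℕ) → size p r ≤ x → colour p r x ≡ nothing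
colour-beyond zero    r x le = refl
colour-beyond (suc p) r x le
  rewrite ¬T⇒≡false (λ t → <⇒≱ (<ᵇ⇒< x (r zero) t) (≤-trans (m≤m+n (r zero) _) le)) =
  cong (Maybe.map suc) (colour-beyond p (λ i → r (suc i)) (x ∸ r zero)
    (subst (_≤ x ∸ r zero) (m+n∸m≡n (r zero) _) (∸-monoˡ-≤ (r zero) le)))

∑-weight-adjoin : (p : ℕ) (r : Fin p → ℕ) {M : ℕ} → colour p r M ≡ nothing → (R : Rel M M) (k : ℕ) →
  ∑ (allRel M 1) (λ c → ∑ (allRel 1 M) (λ d → ∑ (allRel 1 1) (λ e → weight p r (M + 1) (glue R c d e) k)))
  ≡ λe⁻ᵏDeᵏ (weight p r M R) k
∑-weight-adjoin p r {M} uncoloured R k =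
  trans (onEquivalence (T? (isEquivalence M R))) (λe⁻ᵏDeᵏ-scale ⟦ isEquivalence M R ∧ admissible p r M R ⟧ (mono nb) k)
  where
  nb : ℕ
  nb = numBlocks M R
  a : ℕ
  a = ⟦ admissible p r M R ⟧
  extensions : (Rel M 1 → Rel 1 M → Rel 1 1 → ℕ) → ℕ
  extensions F = ∑ (allRel M 1) (λ c → ∑ (allRel 1 M) (λ d → ∑ (allRel 1 1) (λ e → F c d e)))
  onEquivalence : Dec (T (isEquivalence M R)) →
    extensions (λ c d e → weight p r (M + 1) (glue R c d e) k) ≡
    ⟦ isEquivalence M R ∧ admissible p r M R ⟧ * λe⁻ᵏDeᵏ (mono nb) k
  onEquivalence (no ¬eqR) = begin
    extensions (λ c d e → weight p r (M + 1) (glue R c d e) k)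
      ≡⟨ ∑-cong (allRel M 1) (λ c → ∑-cong (allRel 1 M) (λ d → ∑-cong (allRel 1 1) (λ e →
           Adjoin.weight-adjoin-¬equiv R c d e p r ¬eqR k))) ⟩
    extensions (λ _ _ _ → 0)
      ≡⟨ ∑-cong (allRel M 1) (λ c → trans (∑-cong (allRel 1 M) (λ d → ∑-0 (allRel 1 1))) (∑-0 (allRel 1 M))) ⟩
    ∑ (allRel M 1) (λ _ → 0)
      ≡⟨ ∑-0 (allRel M 1) ⟩
    0
      ≡⟨ cong (_* λe⁻ᵏDeᵏ (mono nb) k) (sym (⟦false⟧ (λ t → ¬eqR (∧-fst t)))) ⟩
    ⟦ isEquivalence M R ∧ admissible p r M R ⟧ * λe⁻ᵏDeᵏ (mono nb) k ∎
  onEquivalence (yes eqR) = begin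
    extensions (λ c d e → weight p r (M + 1) (glue R c d e) k)
      ≡⟨ ∑-cong (allRel M 1) (λ c → ∑-cong (allRel 1 M) (λ d → ∑-cong (allRel 1 1) (λ e →
           Adjoin.weight-adjoin R c d e p r uncoloured equiv k))) ⟩
    extensions (λ c d e → ⟦ e zero zero ⟧ * (⟦ row d (λ j → c j zero) ⟧ * (a * Y c)))
      ≡⟨ ∑-cong (allRel M 1) (λ c → ∑-cong (allRel 1 M) (λ d → ∑-entry _)) ⟩
    ∑ (allRel M 1) (λ c → ∑ (allRel 1 M) (λ d → ⟦ row d (λ j → c j zero) ⟧ * (a * Y c)))
      ≡⟨ ∑-cong (allRel M 1) (λ c → trans (∑-*ʳ (allRel 1 M) _ (λ d → ⟦ row d (λ j → c j zero) ⟧))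
                                          (trans (cong (_* (a * Y c)) (∑-row M (λ j → c j zero))) (*-identityˡ _))) ⟩
    ∑ (allRel M 1) (λ c → a * Y c)
      ≡⟨ ∑-*ˡ (allRel M 1) a Y ⟩
    a * ∑ (allRel M 1) Y
      ≡⟨ cong (a *_) ∑Y ⟩
    a * λe⁻ᵏDeᵏ (mono nb) k
      ≡⟨ cong (_* λe⁻ᵏDeᵏ (mono nb) k) (sym (cong ⟦_⟧ (cong (_∧ admissible p r M R) (T⇒≡true eqR)))) ⟩
    ⟦ isEquivalence M R ∧ admissible p r M R ⟧ * λe⁻ᵏDeᵏ (mono nb) k ∎
    where
    equiv : IsEquiv R
    equiv = isEquivalence-sound M R eqR
    Y : Rel M 1 → ℕ
    Y c = ⟦ emptyColumn c ⟧ * mono (suc nb) k + classMatches R c * mono nb k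
    ∑Y : ∑ (allRel M 1) Y ≡ λe⁻ᵏDeᵏ (mono nb) k
    ∑Y = begin
      ∑ (allRel M 1) Y
        ≡⟨ trans (∑-+ (allRel M 1) _ _) (cong₂ _+_ (∑-*ʳ (allRel M 1) _ (λ c → ⟦ emptyColumn c ⟧))
                                                  (∑-*ʳ (allRel M 1) _ (classMatches R))) ⟩
      ∑ (allRel M 1) (λ c → ⟦ emptyColumn c ⟧) * mono (suc nb) k + ∑ (allRel M 1) (classMatches R) * mono nb k
        ≡⟨ cong₂ (λ x y → x * mono (suc nb) k + y * mono nb k) (∑-column M (λ _ → false)) (∑-classMatches R) ⟩
      1 * mono (suc nb) k + nb * mono nb k
        ≡⟨ cong (_+ nb * mono nb k) (*-identityˡ _) ⟩
      mono (suc nb) k + nb * mono nb k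
        ≡⟨ sym (λe⁻ᵏDeᵏ-mono nb k) ⟩
      λe⁻ᵏDeᵏ (mono nb) k ∎

recurrence : (p : ℕ) (r : Fin p → ℕ) (n k : ℕ) → BK p r (suc n) k ≡ λe⁻ᵏDeᵏ (BK p r n) k
recurrence p r n k = begin
  KStirling p r (suc M) k
    ≡⟨ cong (λ N → KStirling p r N k) (+-comm 1 M) ⟩
  KStirling p r (M + 1) k
    ≡⟨ KStirling-∑ p r (M + 1) k ⟩
  ∑ (allRel (M + 1) (M + 1)) (λ R → weight p r (M + 1) R k)
    ≡⟨ ∑-rel-blocks M 1 _ (weight-ext p r (M + 1) k) ⟩
  ∑ (allRel M M) (λ R → ∑ (allRel M 1) (λ c → ∑ (allRel 1 M) (λ d → ∑ (allRel 1 1) (λ e →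
    weight p r (M + 1) (glue R c d e) k))))
    ≡⟨ ∑-cong (allRel M M) (λ R → ∑-weight-adjoin p r uncoloured R k) ⟩
  ∑ (allRel M M) (λ R → λe⁻ᵏDeᵏ (weight p r M R) k)
    ≡⟨ λe⁻ᵏDeᵏ-∑ (allRel M M) (weight p r M) k ⟩
  λe⁻ᵏDeᵏ (λ j → ∑ (allRel M M) (λ R → weight p r M R j)) k
    ≡⟨ λe⁻ᵏDeᵏ-cong (λ j → sym (KStirling-∑ p r M j)) k ⟩
  λe⁻ᵏDeᵏ (BK p r n) k ∎
  where
  M : ℕ
  M = n + size p r
  uncoloured : colour p r M ≡ nothing
  uncoloured = colour-beyond p r M (m≤n+m (size p r) n)

colour-within : (p : ℕ) (r : Fin p → ℕ) (x : ℕ) → x < size p r → Σ (Fin p) (λ i → colour p r x ≡ just i)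
colour-within (suc p) r x x<size with T? (x <ᵇ r zero)
... | yes x<r₀ rewrite T⇒≡true x<r₀ = zero , refl
... | no  x≮r₀ rewrite ¬T⇒≡false x≮r₀
  with colour-within p (λ i → r (suc i)) (x ∸ r zero)
         (subst (x ∸ r zero <_) (m+n∸m≡n (r zero) _)
           (∸-monoˡ-< {x} {r zero} x<size (≮⇒≥ (λ x<r₀ → x≮r₀ (<⇒<ᵇ x<r₀)))))
...   | i , eq = suc i , cong (Maybe.map suc) eq

sameColourOrFree-suc : {p : ℕ} (x y : Maybe (Fin p)) →
  sameColourOrFree (Maybe.map suc x) (Maybe.map suc y) ≡ sameColourOrFree x y
sameColourOrFree-suc (just x) (just y) = bool-ext
  (λ t → fromWitness (Fin-suc-injective (toWitness {a? = suc x Data.Fin.≟ suc y} t)))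
  (λ t → fromWitness (cong suc (toWitness {a? = x Data.Fin.≟ y} t)))
sameColourOrFree-suc (just x) nothing  = refl
sameColourOrFree-suc nothing  y        = refl

-- The colouring with no colours, under which the first class is considered on its own.
noColours : Fin 0 → ℕ
noColours ()

uncoloured-admissible : (N : ℕ) (A : Rel N N) → T (admissible 0 noColours N A)
uncoloured-admissible N A = admissible-complete 0 noColours N A (λ _ _ _ → _)

module FirstClass (p : ℕ) (r : Fin (suc p) → ℕ) where
  a : ℕ
  a = r zero

  r′ : Fin p → ℕ
  r′ i = r (suc i)

  b : ℕ
  b = size p r′

  module _ (A : Rel a a) (B : Rel a b) (C : Rel b a) (D : Rel b b) where
    open Blocks A B C D
    open BlockLeaders A B C D using (numBlocks-glue)

    colour-upper : ∀ i → colourOf (suc p) r (o i) ≡ just zero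
    colour-upper i = trans (cong (colour (suc p) r) (toℕ-↑ˡ i b)) firstClass
      where
      firstClass : colour (suc p) r (toℕ i) ≡ just zero
      firstClass rewrite T⇒≡true (<⇒<ᵇ (toℕ<n i)) = refl

    colour-lower : ∀ j → colourOf (suc p) r (ν j) ≡ Maybe.map suc (colourOf p r′ j)
    colour-lower j = trans (cong (colour (suc p) r) (toℕ-↑ʳ a j)) laterClass
      where
      laterClass : colour (suc p) r (a + toℕ j) ≡ Maybe.map suc (colour p r′ (toℕ j))
      laterClass rewrite ¬T⇒≡false (λ t → <⇒≱ (<ᵇ⇒< (a + toℕ j) a t) (m≤m+n a (toℕ j))) =
        cong (λ x → Maybe.map suc (colour p r′ x)) (m+n∸m≡n a (toℕ j))

    equivA admEquivD : Bool
    equivA    = isEquivalence a A ∧ admissible 0 noColours a A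
    admEquivD = isEquivalence b D ∧ admissible p r′ b D

    lower-coloured : ∀ j → Σ (Fin p) (λ x → colourOf (suc p) r (ν j) ≡ just (suc x))
    lower-coloured j with colour-within p r′ (toℕ j) (toℕ<n j)
    ... | x , eq = x , trans (colour-lower j) (cong (Maybe.map suc) eq)

    module FromAdmissible (adm : Admissible (suc p) r G) where
      no-upper-right : ∀ i j → ¬ T (B i j)
      no-upper-right i j u with lower-coloured j
      ... | x , eq = subst T (cong₂ sameColourOrFree (colour-upper i) eq)
                             (adm (o i) (ν j) (T-back (entry-B i j) u))

      no-lower-left : ∀ j i → ¬ T (C j i)
      no-lower-left j i u with lower-coloured j
      ... | x , eq = subst T (cong₂ sameColourOrFree eq (colour-upper i))
                             (adm (ν j) (o i) (T-back (entry-C j i) u))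

      lower-admissible : Admissible p r′ D
      lower-admissible i j u = subst T (trans (cong₂ sameColourOrFree (colour-lower i) (colour-lower j))
                                              (sameColourOrFree-suc (colourOf p r′ i) (colourOf p r′ j)))
                                       (adm (ν i) (ν j) (T-back (entry-D i j) u))

    module BlockDiagonal (noB : ∀ i j → ¬ T (B i j)) (noC : ∀ j i → ¬ T (C j i)) where
      IsEquiv-blockDiagonal : IsEquiv A → IsEquiv D → IsEquiv G
      IsEquiv-blockDiagonal eqA eqD = record { reflexive = refl′ ; symmetric = sym′ ; transitive = trans′ }
        where
        module EA = IsEquiv eqA
        module ED = IsEquiv eqD
        refl′ : ∀ x → T (G x x)
        refl′ x with half a b x
        ... | left i  = T-back (entry-A i i) (EA.reflexive i)
        ... | right j = T-back (entry-D j j) (ED.reflexive j)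
        sym′ : ∀ x y → T (G x y) → T (G y x)
        sym′ x y u with half a b x | half a b y
        ... | left i  | left j  = T-back (entry-A j i) (EA.symmetric i j (subst T (entry-A i j) u))
        ... | left i  | right j = ⊥-elim (noB i j (subst T (entry-B i j) u))
        ... | right i | left j  = ⊥-elim (noC i j (subst T (entry-C i j) u))
        ... | right i | right j = T-back (entry-D j i) (ED.symmetric i j (subst T (entry-D i j) u))
        trans′ : ∀ x y z → T (G x y) → T (G y z) → T (G x z)
        trans′ x y z u v with half a b x | half a b y | half a b z
        ... | left i  | left j  | left l  =
          T-back (entry-A i l) (EA.transitive i j l (subst T (entry-A i j) u) (subst T (entry-A j l) v))
        ... | left i  | left j  | right l = ⊥-elim (noB j l (subst T (entry-B j l) v))
        ... | left i  | right j | _       = ⊥-elim (noB i j (subst T (entry-B i j) u))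
        ... | right i | left j  | _       = ⊥-elim (noC i j (subst T (entry-C i j) u))
        ... | right i | right j | left l  = ⊥-elim (noC j l (subst T (entry-C j l) v))
        ... | right i | right j | right l =
          T-back (entry-D i l) (ED.transitive i j l (subst T (entry-D i j) u) (subst T (entry-D j l) v))

      admissible-blockDiagonal : Admissible p r′ D → Admissible (suc p) r G
      admissible-blockDiagonal admD x y u with half a b x | half a b y
      ... | left i  | left j  = T-back (cong₂ sameColourOrFree (colour-upper i) (colour-upper j)) _
      ... | left i  | right j = ⊥-elim (noB i j (subst T (entry-B i j) u))
      ... | right i | left j  = ⊥-elim (noC i j (subst T (entry-C i j) u))
      ... | right i | right j =
        T-back (trans (cong₂ sameColourOrFree (colour-lower i) (colour-lower j))
                 (sameColourOrFree-suc (colourOf p r′ i) (colourOf p r′ j)))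
          (admD i j (subst T (entry-D i j) u))

      numBlocks-blockDiagonal : numBlocks (a + b) G ≡ numBlocks a A + numBlocks b D
      numBlocks-blockDiagonal = trans numBlocks-glue (cong (numBlocks a A +_) (sumFin-cong b (λ j →
        cong (λ x → ⟦ x ∧ leader D j ⟧) (T⇒≡true (allFin-intro a (λ i → not-intro (noB i j)))))))

    admissibleEquiv-split : isEquivalence (a + b) G ∧ admissible (suc p) r (a + b) G ≡
      emptyRel B ∧ (emptyRel C ∧ (equivA ∧ admEquivD))
    admissibleEquiv-split = bool-ext toBlocks fromBlocks
      where
      toBlocks : T (isEquivalence (a + b) G ∧ admissible (suc p) r (a + b) G) →
        T (emptyRel B ∧ (emptyRel C ∧ (equivA ∧ admEquivD)))
      toBlocks t = ∧-intro (emptyRel-intro no-upper-right) (∧-intro (emptyRel-intro no-lower-left)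
        (∧-intro (∧-intro (isEquivalence-complete a A eqA) (uncoloured-admissible a A))
                 (∧-intro (isEquivalence-complete b D eqD) (admissible-complete p r′ b D lower-admissible))))
        where
        eqG : IsEquiv G
        eqG = isEquivalence-sound (a + b) G (∧-fst t)
        open FromAdmissible (admissible-sound (suc p) r (a + b) G (∧-snd {isEquivalence (a + b) G} t))
        eqA : IsEquiv A
        eqA = IsEquiv-restrict A o (λ i j → sym (entry-A i j)) eqG
        eqD : IsEquiv D
        eqD = IsEquiv-restrict D ν (λ i j → sym (entry-D i j)) eqG
      fromBlocks : T (emptyRel B ∧ (emptyRel C ∧ (equivA ∧ admEquivD))) →
        T (isEquivalence (a + b) G ∧ admissible (suc p) r (a + b) G)
      fromBlocks t = ∧-intro
        (isEquivalence-complete (a + b) G (IsEquiv-blockDiagonal (isEquivalence-sound a A (∧-fst (∧-fst diagonal)))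
                                                                 (isEquivalence-sound b D (∧-fst lower))))
        (admissible-complete (suc p) r (a + b) G
          (admissible-blockDiagonal (admissible-sound p r′ b D (∧-snd {isEquivalence b D} lower))))
        where
        offDiagonal : T (emptyRel C ∧ (equivA ∧ admEquivD))
        offDiagonal = ∧-snd {emptyRel B} t
        diagonal : T (equivA ∧ admEquivD)
        diagonal = ∧-snd {emptyRel C} offDiagonal
        lower : T admEquivD
        lower = ∧-snd {equivA} diagonal
        open BlockDiagonal (emptyRel-elim (∧-fst t)) (emptyRel-elim (∧-fst offDiagonal))

    weight-split : (k : ℕ) → weight (suc p) r (a + b) G k ≡
      ⟦ emptyRel B ⟧ * (⟦ emptyRel C ⟧ * (weight 0 noColours a A *ₚ weight p r′ b D) k)
    weight-split k = begin
      ⟦ isEquivalence (a + b) G ∧ admissible (suc p) r (a + b) G ⟧ * mono (numBlocks (a + b) G) k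
        ≡⟨ cong (λ x → ⟦ x ⟧ * mono (numBlocks (a + b) G) k) admissibleEquiv-split ⟩
      ⟦ emptyRel B ∧ (emptyRel C ∧ (equivA ∧ admEquivD)) ⟧ * mono (numBlocks (a + b) G) k
        ≡⟨ blocksWhenDiagonal (T? X) ⟩
      ⟦ emptyRel B ∧ (emptyRel C ∧ (equivA ∧ admEquivD)) ⟧ * mono (numBlocks a A + numBlocks b D) k
        ≡⟨ cong₂ _*_ (trans (⟦∧⟧ (emptyRel B) _) (cong (⟦ emptyRel B ⟧ *_) (trans (⟦∧⟧ (emptyRel C) _)
                       (cong (⟦ emptyRel C ⟧ *_) (⟦∧⟧ equivA admEquivD)))))
                     (sym (*ₚ-mono (numBlocks a A) (numBlocks b D) k)) ⟩
      ⟦ emptyRel B ⟧ * (⟦ emptyRel C ⟧ * (⟦ equivA ⟧ * ⟦ admEquivD ⟧)) * (mono (numBlocks a A) *ₚ mono (numBlocks b D)) k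
        ≡⟨ rearrange ⟦ emptyRel B ⟧ ⟦ emptyRel C ⟧ (⟦ equivA ⟧ * ⟦ admEquivD ⟧) _ ⟩
      ⟦ emptyRel B ⟧ * (⟦ emptyRel C ⟧ * (⟦ equivA ⟧ * ⟦ admEquivD ⟧ * (mono (numBlocks a A) *ₚ mono (numBlocks b D)) k))
        ≡⟨ cong (λ x → ⟦ emptyRel B ⟧ * (⟦ emptyRel C ⟧ * x))
                (sym (*ₚ-scale ⟦ equivA ⟧ ⟦ admEquivD ⟧ (mono (numBlocks a A)) (mono (numBlocks b D)) k)) ⟩
      ⟦ emptyRel B ⟧ * (⟦ emptyRel C ⟧ * (weight 0 noColours a A *ₚ weight p r′ b D) k) ∎
      where
      rearrange : ∀ x y z w → x * (y * z) * w ≡ x * (y * (z * w))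
      rearrange = solve-∀
      X : Bool
      X = emptyRel B ∧ (emptyRel C ∧ (equivA ∧ admEquivD))
      -- The block count only matters when the off-diagonal blocks are empty.
      blocksWhenDiagonal : Dec (T X) →
        ⟦ X ⟧ * mono (numBlocks (a + b) G) k ≡ ⟦ X ⟧ * mono (numBlocks a A + numBlocks b D) k
      blocksWhenDiagonal (no ¬x) rewrite ⟦false⟧ ¬x = refl
      blocksWhenDiagonal (yes x) = cong (λ m → ⟦ X ⟧ * mono m k)
        (BlockDiagonal.numBlocks-blockDiagonal (emptyRel-elim (∧-fst x)) (emptyRel-elim (∧-fst (∧-snd {emptyRel B} x))))

  ∑-weight-split : (A : Rel a a) (k : ℕ) →
    ∑ (allRel a b) (λ B → ∑ (allRel b a) (λ C → ∑ (allRel b b) (λ D → weight (suc p) r (a + b) (glue A B C D) k)))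
    ≡ ∑ (allRel b b) (λ D → (weight 0 noColours a A *ₚ weight p r′ b D) k)
  ∑-weight-split A k = begin
    ∑ (allRel a b) (λ B → ∑ (allRel b a) (λ C → ∑ (allRel b b) (λ D → weight (suc p) r (a + b) (glue A B C D) k)))
      ≡⟨ ∑-cong (allRel a b) (λ B → ∑-cong (allRel b a) (λ C →
           trans (∑-cong (allRel b b) (λ D → weight-split A B C D k))
                 (trans (∑-*ˡ (allRel b b) ⟦ emptyRel B ⟧ _) (cong (⟦ emptyRel B ⟧ *_) (∑-*ˡ (allRel b b) ⟦ emptyRel C ⟧ Z))))) ⟩
    ∑ (allRel a b) (λ B → ∑ (allRel b a) (λ C → ⟦ emptyRel B ⟧ * (⟦ emptyRel C ⟧ * ∑ (allRel b b) Z)))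
      ≡⟨ ∑-cong (allRel a b) (λ B → trans (∑-*ˡ (allRel b a) ⟦ emptyRel B ⟧ _)
           (cong (⟦ emptyRel B ⟧ *_) (∑-emptyRel-* b a (∑ (allRel b b) Z)))) ⟩
    ∑ (allRel a b) (λ B → ⟦ emptyRel B ⟧ * ∑ (allRel b b) Z)
      ≡⟨ ∑-emptyRel-* a b (∑ (allRel b b) Z) ⟩
    ∑ (allRel b b) Z ∎
    where
    Z : Rel b b → ℕ
    Z D = (weight 0 noColours a A *ₚ weight p r′ b D) k

numBlocks-≤ : (N : ℕ) (R : Rel N N) → numBlocks N R ≤ N
numBlocks-≤ N R = atMostOne N (λ i → ⟦ leader R i ⟧) (λ i → indicator≤1 (leader R i))
  where
  indicator≤1 : ∀ x → ⟦ x ⟧ ≤ 1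
  indicator≤1 true  = s≤s z≤n
  indicator≤1 false = z≤n
  atMostOne : (n : ℕ) (f : Fin n → ℕ) → (∀ i → f i ≤ 1) → sumFin n f ≤ n
  atMostOne zero    f h = z≤n
  atMostOne (suc n) f h = +-mono-≤ (h zero) (atMostOne n (λ i → f (suc i)) (λ i → h (suc i)))

bell-KStirling : (m j : ℕ) → bell m j ≡ KStirling 0 noColours m j
bell-KStirling m j with T? (j ≤ᵇ m)
... | yes j≤m rewrite T⇒≡true j≤m = refl
... | no  j≰m rewrite ¬T⇒≡false j≰m = sym (trans (KStirling-∑ 0 noColours m j) (trans (∑-cong (allRel m m) (λ R →
        trans (cong (E R *_) (⟦false⟧ (λ t →
                j≰m (≤⇒≤ᵇ (subst (_≤ m) (≡ᵇ⇒≡ (numBlocks m R) j t) (numBlocks-≤ m R))))))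
              (*-zeroʳ (E R)))) (∑-0 (allRel m m))))
  where
  E : Rel m m → ℕ
  E R = ⟦ isEquivalence m R ∧ admissible 0 noColours m R ⟧

initialValue : (p : ℕ) (r : Fin p → ℕ) (k : ℕ) → KStirling p r (size p r) k ≡ prodPoly p (λ i → bell (r i)) k
initialValue zero    r zero    = refl
initialValue zero    r (suc k) = refl
initialValue (suc p) r k = begin
  KStirling (suc p) r (a + b) k
    ≡⟨ KStirling-∑ (suc p) r (a + b) k ⟩
  ∑ (allRel (a + b) (a + b)) (λ R → weight (suc p) r (a + b) R k)
    ≡⟨ ∑-rel-blocks a b _ (weight-ext (suc p) r (a + b) k) ⟩
  ∑ (allRel a a) (λ A → ∑ (allRel a b) (λ B → ∑ (allRel b a) (λ C → ∑ (allRel b b) (λ D →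
    weight (suc p) r (a + b) (glue A B C D) k))))
    ≡⟨ ∑-cong (allRel a a) (λ A → ∑-weight-split A k) ⟩
  ∑ (allRel a a) (λ A → ∑ (allRel b b) (λ D → (weight 0 noColours a A *ₚ weight p r′ b D) k))
    ≡⟨ *ₚ-∑ (allRel a a) (allRel b b) (weight 0 noColours a) (weight p r′ b) k ⟩
  ((λ j → ∑ (allRel a a) (λ A → weight 0 noColours a A j)) *ₚ (λ j → ∑ (allRel b b) (λ D → weight p r′ b D j))) k
    ≡⟨ *ₚ-cong (λ j → sym (trans (bell-KStirling a j) (KStirling-∑ 0 noColours a j)))
               (λ j → trans (sym (KStirling-∑ p r′ b j)) (initialValue p r′ j)) k ⟩
  prodPoly (suc p) (λ i → bell (r i)) k ∎
  where open FirstClass p r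

mainTheorem7 : (p : ℕ) → 2 ≤ p → (r : Fin p → ℕ) → (∀ i → 1 ≤ r i) →
    ((n : ℕ) → (k : ℕ) → BK p r (suc n) k ≡ λe⁻ᵏDeᵏ (BK p r n) k) ×
    ((k : ℕ) → BK p r 0 k ≡ prodPoly p (λ i → bell (r i)) k)
mainTheorem7 p _ r _ = recurrence p r , initialValue p r
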